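{- Let $p\ge7$ be prime. Then $U_p\in pq\mathbf{Z}_{(p)}[[q]]$ and: (i) for every integer $k\ge1$, $v_p(U_p^k/k!)\ge k-v_p(k!)\ge k-\frac{k-1}{p-1}$; in particular $v_p(U_p^k/k!)\ge4$ for $k\ge4$, so $e^{ -XU_p}\bmod X^4$ has coefficients in $\mathbf{Z}_{(p)}[[q]]$ and $\sum_{k\ge4}(-X)^kU_p^k/k!\in p^4\mathbf{Z}_{(p)}[[q]][[X]]$; (ii) $e^{ -XU_p}\equiv 1+\sum_{\ell=1}^3\frac{(-X)^\ell}{\ell!}U_p^\ell$ and $e^{XU_p}\equiv 1+\sum_{\ell=1}^3\frac{X^\ell}{\ell!}U_p^\ell\pmod{(p^4,X^4)}$; (iii) in $\mathbf{Q}_p[[q]][[X]]$, $H_{\mathrm{mix}}(q)^{pX}=H_{\mathrm{mix}}(q^p)^X\,e^{ -XU_p(q)}$; (iv) for every integer $m\ge1$, $H_{\mathrm{mix}}(q)^{mp}\equiv H_{\mathrm{mix}}(q^p)^m\sum_{\ell=0}^3\frac{(-m)^\ell}{\ell!}U_p^\ell\pmod{p^4}$, both sides being in $\mathbf{Z}_{(p)}[[q]]$.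
   Context: Put $u(q):=q\prod_{n\ge1}(1-q^{3n})^{12}/(1-q^n)^{12}$, $t(q):=u/(1+27u)^2$, $H_{\mathrm{mix}}:=q/t\in1+q\mathbf{Z}[[q]]$, and $U_p(q):=\log(t(q)^p/t(q^p))$. For a power series $f$, $v_p(f)$ is the minimum $p$-adic valuation of its coefficients. Formal powers $H^X$ mean $\exp(X\log H)$. Congruence modulo $(p^4,X^4)$ means the coefficients of $X^0,\dots,X^3$ agree modulo $p^4\mathbf{Z}_{(p)}[[q]]$. -}

module Defs where

open import Data.Bool using (Bool; true; false; if_then_else_)
open import Data.Nat as ℕ using (ℕ; zero; suc; _∸_; _≟_; _!)
open import Data.Nat.Properties using (_!≢0)
open import Data.Nat.Divisibility using (_∣_; _∣?_)
open import Data.Integer as ℤ using (ℤ; +_; -[1+_])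
open import Data.Rational using (ℚ; 0ℚ; 1ℚ; _+_; _*_; -_; _-_; _/_) renaming (↥_ to num; ↧ₙ_ to denℕ)

open import Data.List using (List; []; _∷_)
open import Data.Product using (_×_)
open import Relation.Nullary using (¬_; does)

-- Formal power series in q with rational coefficients: n ↦ [q^n] f

PS : Set
PS = ℕ → ℚ

sumQ : ℕ → (ℕ → ℚ) → ℚ
sumQ zero    f = 0ℚ
sumQ (suc n) f = sumQ n f + f n

ℕtoℚ : ℕ → ℚ
ℕtoℚ k = (+ k) / 1

invFact : ℕ → ℚ
invFact k = _/_ (+ 1) (k !) {{k !≢0}}

invSuc : ℕ → ℚ
invSuc k = (+ 1) / suc k

powQ : ℚ → ℕ → ℚ
powQ x zero    = 1ℚ
powQ x (suc k) = x * powQ x k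

oneS : PS
oneS zero    = 1ℚ
oneS (suc n) = 0ℚ

monoS : ℚ → ℕ → PS
monoS c m n = if does (n ≟ m) then c else 0ℚ

addS : PS → PS → PS
addS f g n = f n + g n

subS : PS → PS → PS
subS f g n = f n - g n

scaleS : ℚ → PS → PS
scaleS c f n = c * f n

mulS : PS → PS → PS
mulS f g n = sumQ (suc n) (λ i → f i * g (n ∸ i))

powS : PS → ℕ → PS
powS f zero    = oneS
powS f (suc k) = mulS f (powS f k)

sumS : ℕ → (ℕ → PS) → PS
sumS n F m = sumQ n (λ i → F i m)

-- multiplication by q
shiftS : PS → PS
shiftS f zero    = 0ℚ
shiftS f (suc n) = f n

-- f(q^d) :  [q^n] f(q^d) = Σ_{i ≤ n, d i = n} [q^i] f
substPow : ℕ → PS → PS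
substPow d f n = sumQ (suc n) (λ i → if does (d ℕ.* i ≟ n) then f i else 0ℚ)

-- Multiplicative inverse of a series with constant term 1:
-- g_0 = 1, g_{n} = - Σ_{i=1}^{n} f_i g_{n-i}.
-- invList f n = [g_n , g_{n-1} , … , g_0]
private
  lookupD : List ℚ → ℕ → ℚ
  lookupD []       _       = 0ℚ
  lookupD (x ∷ xs) zero    = x
  lookupD (x ∷ xs) (suc j) = lookupD xs j

  headD : List ℚ → ℚ
  headD []      = 0ℚ
  headD (x ∷ _) = x

invList : PS → ℕ → List ℚ
invList f zero    = 1ℚ ∷ []
invList f (suc n) =
  let gs = invList f n in
  (- sumQ (suc n) (λ j → f (suc j) * lookupD gs j)) ∷ gs

invS : PS → PS
invS f n = headD (invList f n)

-- log of a series with constant term 1: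
-- log f = Σ_{k≥1} (-1)^{k+1} (f-1)^k / k ; the q^n-coefficient only
-- involves k ≤ n since (f-1) has zero constant term.
logS : PS → PS
logS f n = sumQ n (λ j → (powQ (- 1ℚ) j * invSuc j) * powS (subS f oneS) (suc j) n)

-- Series in X with coefficients in ℚ[[q]]:  j ↦ [X^j] F ∈ ℚ[[q]]

BPS : Set
BPS = ℕ → PS

zeroS : PS
zeroS _ = 0ℚ

mulB : BPS → BPS → BPS
mulB A B j = sumS (suc j) (λ i → mulS (A i) (B (j ∸ i)))

powB : BPS → ℕ → BPS
powB A zero    zero    = oneS
powB A zero    (suc j) = zeroS
powB A (suc k)         = mulB A (powB A k)

linX : PS → BPS
linX L zero          = zeroS
linX L (suc zero)    = L
linX L (suc (suc j)) = zeroS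

-- exp(Y) = Σ_k Y^k/k! for Y with zero X-constant term;
-- [X^j] only involves k ≤ j.
expB : BPS → BPS
expB Y j = sumS (suc j) (λ k → scaleS (invFact k) (powB Y k j))

-- formal power H^{c X} := exp(c X log H)
fpowX : PS → ℚ → BPS
fpowX H c = expB (linX (scaleS c (logS H)))

etaFactor : ℕ → PS
etaFactor n = mulS (powS (subS oneS (monoS 1ℚ (3 ℕ.* n))) 12)
                   (invS (powS (subS oneS (monoS 1ℚ n)) 12))

prodTo : ℕ → PS
prodTo zero    = oneS
prodTo (suc N) = mulS (prodTo N) (etaFactor (suc N))

-- infinite product Π_{n≥1}: factor n is ≡ 1 mod q^n, so the q^N
-- coefficient is that of the finite product up to N.
etaProd : PS
etaProd N = prodTo N N

u : PS
u = shiftS etaProd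

-- t = q · tq,  tq = etaProd / (1+27u)^2
tq : PS
tq = mulS etaProd (invS (powS (addS oneS (scaleS (ℕtoℚ 27) u)) 2))

t : PS
t = shiftS tq

-- H_mix = q / t = 1 / tq
Hmix : PS
Hmix = invS tq

-- t(q)^p / t(q^p) = q^p tq^p / (q^p tq(q^p)) = tq^p / tq(q^p)
tRatio : ℕ → PS
tRatio p = mulS (powS tq p) (invS (substPow p tq))

U : ℕ → PS
U p = logS (tRatio p)

-- x ∈ p^e ℤ_(p)   (ℚ is kept in lowest terms)
InPZ : ℕ → ℕ → ℚ → Set
InPZ p e x = (¬ (p ∣ denℕ x)) × ((p ℕ.^ e) ∣ ℤ.∣ num x ∣)

ValGe : ℕ → ℕ → PS → Set
ValGe p e f = ∀ n → InPZ p e (f n)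

CongP : ℕ → ℕ → PS → PS → Set
CongP p e f g = ValGe p e (subS f g)

CongP4X4 : ℕ → BPS → BPS → Set
CongP4X4 p F G = ∀ j → j ℕ.< 4 → CongP p 4 (F j) (G j)

private
  largest : (ℕ → Bool) → ℕ → ℕ
  largest P zero    = zero
  largest P (suc b) = if P (suc b) then suc b else largest P b

-- p-adic valuation of a positive natural number n (for p ≥ 2,
-- v_p(n) ≤ n, so searching e ≤ n suffices)
vp : ℕ → ℕ → ℕ
vp p n = largest (λ e → does ((p ℕ.^ e) ∣? n)) n

truncExp3 : ℚ → PS → BPS
truncExp3 c V j = if does (j ℕ.<? 4)
                  then scaleS (powQ c j * invFact j) (powS V j)
                  else zeroS

{-# OPTIONS --safe #-}
-- Since t(q)/q and H = q/t have constant term 1, their logarithms exist, and log(t(q)^p/t(q^p)) = U_p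
-- becomes p log H(q) = log H(q^p) - U_p; exponentiating gives (iii) and, at X = m,
-- H^{mp} = H(q^p)^m exp(-m U_p). Frobenius, f(q)^p ≡ f(q^p) (mod p) for f ∈ ℤ_(p)[[q]] (freshman's
-- dream plus Fermat), puts t^p/t(q^p) in 1 + pℤ_(p)[[q]], hence U_p in pℤ_(p)[[q]]. Legendre's bound
-- (p-1) v_p(k!) ≤ k-1 then makes U_p^k/k! divisible by p^{k - v_p(k!)}, hence by p^4 for k ≥ 4 when
-- p ≥ 7, and this truncates exp(-m U_p) modulo p^4.
module Submission where

open import Data.Nat using (ℕ; _≤_)
open import Data.Nat.Primality using (Prime)

module RationalArithmetic where

  open import Defs using (ℕtoℚ; invSuc; invFact; powQ)
  open import Data.Nat as ℕ using (ℕ; zero; suc; _!)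
  import Data.Nat.Properties as ℕ
  open import Data.Integer as ℤ using (ℤ; +_)
  import Data.Integer.Properties as ℤ
  open import Data.Rational using (ℚ; mkℚ; 1ℚ; _+_; _*_; -_; _/_; ↥_; ↧_; toℚᵘ)
  open import Data.Rational.Properties
    using (toℚᵘ-injective; toℚᵘ-fromℚᵘ; toℚᵘ-cong; toℚᵘ-homo-+; toℚᵘ-homo-*; toℚᵘ-homo‿-; *-identityˡ; *-assoc; *-comm)
  open import Data.Rational.Unnormalised as ℚᵘ using (mkℚᵘ; *≡*) renaming (_≃_ to _≃ᵘ_)
  import Data.Rational.Unnormalised.Properties as ℚᵘ
  open import Data.Rational.Solver using (module +-*-Solver)
  open import Relation.Binary.PropositionalEquality

  open +-*-Solver

  ℤtoℚ : ℤ → ℚ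
  ℤtoℚ z = z / 1

  toℚᵘ-/ : ∀ z d .{{_ : ℕ.NonZero d}} → toℚᵘ (z / d) ≃ᵘ mkℚᵘ z (ℕ.pred d)
  toℚᵘ-/ z (suc d) = toℚᵘ-fromℚᵘ (mkℚᵘ z d)

  ℤtoℚ-+ : ∀ a b → ℤtoℚ (a ℤ.+ b) ≡ ℤtoℚ a + ℤtoℚ b
  ℤtoℚ-+ a b = toℚᵘ-injective (begin
    toℚᵘ (ℤtoℚ (a ℤ.+ b))            ≈⟨ toℚᵘ-/ (a ℤ.+ b) 1 ⟩
    mkℚᵘ (a ℤ.+ b) 0                  ≈⟨ *≡* (cong₂ ℤ._*_ (cong₂ ℤ._+_ (sym (ℤ.*-identityʳ a)) (sym (ℤ.*-identityʳ b))) refl) ⟩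
    mkℚᵘ a 0 ℚᵘ.+ mkℚᵘ b 0            ≈⟨ ℚᵘ.+-cong (toℚᵘ-/ a 1) (toℚᵘ-/ b 1) ⟨
    toℚᵘ (ℤtoℚ a) ℚᵘ.+ toℚᵘ (ℤtoℚ b)  ≈⟨ toℚᵘ-homo-+ (ℤtoℚ a) (ℤtoℚ b) ⟨
    toℚᵘ (ℤtoℚ a + ℤtoℚ b)            ∎)
    where open ℚᵘ.≃-Reasoning

  ℤtoℚ-* : ∀ a b → ℤtoℚ (a ℤ.* b) ≡ ℤtoℚ a * ℤtoℚ b
  ℤtoℚ-* a b = toℚᵘ-injective (begin
    toℚᵘ (ℤtoℚ (a ℤ.* b))            ≈⟨ toℚᵘ-/ (a ℤ.* b) 1 ⟩
    mkℚᵘ a 0 ℚᵘ.* mkℚᵘ b 0            ≈⟨ ℚᵘ.*-cong (toℚᵘ-/ a 1) (toℚᵘ-/ b 1) ⟨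
    toℚᵘ (ℤtoℚ a) ℚᵘ.* toℚᵘ (ℤtoℚ b)  ≈⟨ toℚᵘ-homo-* (ℤtoℚ a) (ℤtoℚ b) ⟨
    toℚᵘ (ℤtoℚ a * ℤtoℚ b)            ∎)
    where open ℚᵘ.≃-Reasoning

  ℤtoℚ-neg : ∀ a → ℤtoℚ (ℤ.- a) ≡ - ℤtoℚ a
  ℤtoℚ-neg a = toℚᵘ-injective (begin
    toℚᵘ (ℤtoℚ (ℤ.- a))     ≈⟨ toℚᵘ-/ (ℤ.- a) 1 ⟩
    ℚᵘ.- mkℚᵘ a 0           ≈⟨ ℚᵘ.-‿cong (toℚᵘ-/ a 1) ⟨
    ℚᵘ.- toℚᵘ (ℤtoℚ a)      ≈⟨ toℚᵘ-homo‿- (ℤtoℚ a) ⟨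
    toℚᵘ (- ℤtoℚ a)         ∎)
    where open ℚᵘ.≃-Reasoning

  ℕtoℚ-+ : ∀ a b → ℕtoℚ (a ℕ.+ b) ≡ ℕtoℚ a + ℕtoℚ b
  ℕtoℚ-+ a b = trans (cong ℤtoℚ (ℤ.pos-+ a b)) (ℤtoℚ-+ (+ a) (+ b))

  ℕtoℚ-* : ∀ a b → ℕtoℚ (a ℕ.* b) ≡ ℕtoℚ a * ℕtoℚ b
  ℕtoℚ-* a b = trans (cong ℤtoℚ (ℤ.pos-* a b)) (ℤtoℚ-* (+ a) (+ b))

  ℕtoℚ-suc : ∀ a → ℕtoℚ (suc a) ≡ 1ℚ + ℕtoℚ a
  ℕtoℚ-suc = ℕtoℚ-+ 1

  d*1/[d*e]≡1/e : ∀ d e .{{_ : ℕ.NonZero e}} .{{_ : ℕ.NonZero (d ℕ.* e)}} →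
                   ℕtoℚ d * ((+ 1) / (d ℕ.* e)) ≡ (+ 1) / e
  d*1/[d*e]≡1/e d e {{_}} {{de≢0}} = toℚᵘ-injective (begin
    toℚᵘ (ℕtoℚ d * ((+ 1) / (d ℕ.* e)))                ≈⟨ toℚᵘ-homo-* (ℕtoℚ d) _ ⟩
    toℚᵘ (ℕtoℚ d) ℚᵘ.* toℚᵘ ((+ 1) / (d ℕ.* e))        ≈⟨ ℚᵘ.*-cong (toℚᵘ-/ (+ d) 1) (toℚᵘ-/ (+ 1) (d ℕ.* e)) ⟩
    mkℚᵘ (+ d) 0 ℚᵘ.* mkℚᵘ (+ 1) (ℕ.pred (d ℕ.* e))    ≈⟨ *≡* cross ⟩
    mkℚᵘ (+ 1) (ℕ.pred e)                              ≈⟨ toℚᵘ-/ (+ 1) e ⟨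
    toℚᵘ ((+ 1) / e)                                   ∎)
    where
    open ℚᵘ.≃-Reasoning
    cross : (+ d ℤ.* + 1) ℤ.* + suc (ℕ.pred e) ≡ + 1 ℤ.* + (1 ℕ.* suc (ℕ.pred (d ℕ.* e)))
    cross = trans (cong₂ (λ x y → x ℤ.* + y) (ℤ.*-identityʳ (+ d)) (ℕ.suc-pred e))
                  (trans (sym (ℤ.pos-* d e))
                  (trans (cong +_ (sym (trans (ℕ.*-identityˡ _) (ℕ.suc-pred (d ℕ.* e) {{de≢0}})))) (sym (ℤ.*-identityˡ _))))

  d*1/d≡1 : ∀ d .{{_ : ℕ.NonZero d}} → ℕtoℚ d * ((+ 1) / d) ≡ 1ℚ
  d*1/d≡1 (suc d) = toℚᵘ-injective (begin
    toℚᵘ (ℕtoℚ (suc d) * ((+ 1) / suc d))            ≈⟨ toℚᵘ-homo-* (ℕtoℚ (suc d)) _ ⟩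
    toℚᵘ (ℕtoℚ (suc d)) ℚᵘ.* toℚᵘ ((+ 1) / suc d)    ≈⟨ ℚᵘ.*-cong (toℚᵘ-/ (+ suc d) 1) (toℚᵘ-/ (+ 1) (suc d)) ⟩
    mkℚᵘ (+ suc d) 0 ℚᵘ.* mkℚᵘ (+ 1) d               ≈⟨ *≡* (trans (ℤ.*-identityʳ _) (trans (ℤ.*-identityʳ _)
                                                        (trans (cong +_ (sym (ℕ.*-identityˡ (suc d)))) (sym (ℤ.*-identityˡ _))))) ⟩
    ℚᵘ.1ℚᵘ                                          ∎)
    where open ℚᵘ.≃-Reasoning

  invSuc-inverse : ∀ n → ℕtoℚ (suc n) * invSuc n ≡ 1ℚ
  invSuc-inverse n = d*1/d≡1 (suc n)

  invFact-inverse : ∀ k → ℕtoℚ (k !) * invFact k ≡ 1ℚ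
  invFact-inverse k = d*1/d≡1 (k !) {{k ℕ.!≢0}}

  ℕtoℚ-suc*invFact-suc : ∀ j → ℕtoℚ (suc j) * invFact (suc j) ≡ invFact j
  ℕtoℚ-suc*invFact-suc j = d*1/[d*e]≡1/e (suc j) (j !) {{j ℕ.!≢0}} {{suc j ℕ.!≢0}}

  ℕtoℚ-suc-cancelˡ : ∀ n {a b} → ℕtoℚ (suc n) * a ≡ ℕtoℚ (suc n) * b → a ≡ b
  ℕtoℚ-suc-cancelˡ n {a} {b} e = begin
    a                        ≡⟨ *-identityˡ a ⟨
    1ℚ * a                   ≡⟨ cong (_* a) inverse ⟨
    invSuc n * N * a         ≡⟨ *-assoc (invSuc n) N a ⟩
    invSuc n * (N * a)       ≡⟨ cong (invSuc n *_) e ⟩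
    invSuc n * (N * b)       ≡⟨ *-assoc (invSuc n) N b ⟨
    invSuc n * N * b         ≡⟨ cong (_* b) inverse ⟩
    1ℚ * b                   ≡⟨ *-identityˡ b ⟩
    b                        ∎
    where
    open ≡-Reasoning
    N : ℚ
    N = ℕtoℚ (suc n)
    inverse : invSuc n * N ≡ 1ℚ
    inverse = trans (*-comm (invSuc n) N) (invSuc-inverse n)

  powQ-1ℚ : ∀ k → powQ 1ℚ k ≡ 1ℚ
  powQ-1ℚ zero    = refl
  powQ-1ℚ (suc k) = trans (*-identityˡ (powQ 1ℚ k)) (powQ-1ℚ k)

  powQ-* : ∀ x y k → powQ (x * y) k ≡ powQ x k * powQ y k
  powQ-* x y zero    = refl
  powQ-* x y (suc k) = trans (cong (x * y *_) (powQ-* x y k))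
    (solve 4 (λ x y a b → x :* y :* (a :* b) := x :* a :* (y :* b)) refl x y (powQ x k) (powQ y k))

  x*b≡c⇒↥x*b≡c*↧x : ∀ x b c → x * ℕtoℚ b ≡ ℤtoℚ c → ↥ x ℤ.* + b ≡ c ℤ.* ↧ x
  x*b≡c⇒↥x*b≡c*↧x x@(mkℚ n d _) b c e = from-ℚᵘ in-ℚᵘ
    where
    in-ℚᵘ : mkℚᵘ n d ℚᵘ.* mkℚᵘ (+ b) 0 ≃ᵘ mkℚᵘ c 0
    in-ℚᵘ = begin
      mkℚᵘ n d ℚᵘ.* mkℚᵘ (+ b) 0           ≈⟨ ℚᵘ.*-cong (ℚᵘ.≃-refl {mkℚᵘ n d}) (toℚᵘ-/ (+ b) 1) ⟨
      toℚᵘ x ℚᵘ.* toℚᵘ (ℕtoℚ b)            ≈⟨ toℚᵘ-homo-* x (ℕtoℚ b) ⟨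
      toℚᵘ (x * ℕtoℚ b)                    ≈⟨ toℚᵘ-cong e ⟩
      toℚᵘ (ℤtoℚ c)                        ≈⟨ toℚᵘ-/ c 1 ⟩
      mkℚᵘ c 0                             ∎
      where open ℚᵘ.≃-Reasoning
    from-ℚᵘ : mkℚᵘ n d ℚᵘ.* mkℚᵘ (+ b) 0 ≃ᵘ mkℚᵘ c 0 → ↥ x ℤ.* + b ≡ c ℤ.* ↧ x
    from-ℚᵘ (*≡* cross) = trans (sym (ℤ.*-identityʳ _)) (trans cross (cong (λ k → c ℤ.* + k) (ℕ.*-identityʳ (suc d))))

module FiniteSums where

  open import Defs using (sumQ)
  open import Data.Bool using (if_then_else_)
  open import Data.Nat as ℕ using (ℕ; zero; suc; _≤_; _<_; _≟_)
  import Data.Nat.Properties as ℕ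
  open import Data.Rational using (ℚ; 0ℚ; _+_; _*_; -_; _-_)
  open import Data.Rational.Properties
    using (+-assoc; +-identityˡ; +-identityʳ; *-comm; *-zeroʳ; *-distribˡ-+; neg-distrib-+)
  open import Data.Rational.Solver using (module +-*-Solver)
  open import Data.Sum using (inj₁; inj₂)
  open import Relation.Nullary using (¬_; does; yes; no)
  open import Relation.Nullary.Decidable using (dec-true; dec-false)
  open import Relation.Binary.PropositionalEquality

  open +-*-Solver

  sumQ-cong-< : ∀ n {f g : ℕ → ℚ} → (∀ i → i < n → f i ≡ g i) → sumQ n f ≡ sumQ n g
  sumQ-cong-< zero    e = refl
  sumQ-cong-< (suc n) e = cong₂ _+_ (sumQ-cong-< n (λ i i<n → e i (ℕ.m<n⇒m<1+n i<n))) (e n (ℕ.n<1+n n))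

  sumQ-cong : ∀ n {f g : ℕ → ℚ} → (∀ i → f i ≡ g i) → sumQ n f ≡ sumQ n g
  sumQ-cong n e = sumQ-cong-< n (λ i _ → e i)

  sumQ-vanish : ∀ n (f : ℕ → ℚ) → (∀ i → i < n → f i ≡ 0ℚ) → sumQ n f ≡ 0ℚ
  sumQ-vanish zero    f e = refl
  sumQ-vanish (suc n) f e =
    cong₂ _+_ (sumQ-vanish n f (λ i i<n → e i (ℕ.m<n⇒m<1+n i<n))) (e n (ℕ.n<1+n n))

  sumQ-+ : ∀ n (f g : ℕ → ℚ) → sumQ n (λ i → f i + g i) ≡ sumQ n f + sumQ n g
  sumQ-+ zero    f g = refl
  sumQ-+ (suc n) f g = trans (cong (_+ (f n + g n)) (sumQ-+ n f g))
    (solve 4 (λ a b c d → (a :+ b) :+ (c :+ d) := (a :+ c) :+ (b :+ d)) refl (sumQ n f) (sumQ n g) (f n) (g n))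

  sumQ-*ˡ : ∀ n c (f : ℕ → ℚ) → c * sumQ n f ≡ sumQ n (λ i → c * f i)
  sumQ-*ˡ zero    c f = *-zeroʳ c
  sumQ-*ˡ (suc n) c f = trans (*-distribˡ-+ c (sumQ n f) (f n)) (cong (_+ c * f n) (sumQ-*ˡ n c f))

  sumQ-*ʳ : ∀ n c (f : ℕ → ℚ) → sumQ n f * c ≡ sumQ n (λ i → f i * c)
  sumQ-*ʳ n c f = trans (*-comm (sumQ n f) c) (trans (sumQ-*ˡ n c f) (sumQ-cong n (λ i → *-comm c (f i))))

  sumQ-neg : ∀ n (f : ℕ → ℚ) → - sumQ n f ≡ sumQ n (λ i → - f i)
  sumQ-neg zero    f = refl
  sumQ-neg (suc n) f = trans (neg-distrib-+ (sumQ n f) (f n)) (cong (_+ (- f n)) (sumQ-neg n f))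

  sumQ-- : ∀ n (f g : ℕ → ℚ) → sumQ n (λ i → f i - g i) ≡ sumQ n f - sumQ n g
  sumQ-- n f g = trans (sumQ-+ n f (λ i → - g i)) (cong (sumQ n f +_) (sym (sumQ-neg n g)))

  sumQ-head : ∀ n (f : ℕ → ℚ) → sumQ (suc n) f ≡ f 0 + sumQ n (λ i → f (suc i))
  sumQ-head zero    f = trans (+-identityˡ (f 0)) (sym (+-identityʳ (f 0)))
  sumQ-head (suc n) f = trans (cong (_+ f (suc n)) (sumQ-head n f)) (+-assoc (f 0) _ _)

  sumQ-split : ∀ a b (f : ℕ → ℚ) → sumQ (a ℕ.+ b) f ≡ sumQ a f + sumQ b (λ i → f (a ℕ.+ i))
  sumQ-split a zero    f = trans (cong (λ t → sumQ t f) (ℕ.+-identityʳ a)) (sym (+-identityʳ (sumQ a f)))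
  sumQ-split a (suc b) f = trans (cong (λ t → sumQ t f) (ℕ.+-suc a b))
    (trans (cong (_+ f (a ℕ.+ b)) (sumQ-split a b f)) (+-assoc (sumQ a f) _ (f (a ℕ.+ b))))

  sumQ-extend : ∀ n m (f : ℕ → ℚ) → n ≤ m → (∀ i → n ≤ i → i < m → f i ≡ 0ℚ) → sumQ n f ≡ sumQ m f
  sumQ-extend n m f n≤m zeros = begin
    sumQ n f                                        ≡⟨ +-identityʳ (sumQ n f) ⟨
    sumQ n f + 0ℚ                                   ≡⟨ cong (sumQ n f +_) tail-vanishes ⟨
    sumQ n f + sumQ (m ℕ.∸ n) (λ i → f (n ℕ.+ i))   ≡⟨ sumQ-split n (m ℕ.∸ n) f ⟨
    sumQ (n ℕ.+ (m ℕ.∸ n)) f                        ≡⟨ cong (λ k → sumQ k f) (ℕ.m+[n∸m]≡n n≤m) ⟩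
    sumQ m f                                        ∎
    where
    open ≡-Reasoning
    tail-vanishes : sumQ (m ℕ.∸ n) (λ i → f (n ℕ.+ i)) ≡ 0ℚ
    tail-vanishes = sumQ-vanish (m ℕ.∸ n) _ (λ i i<m∸n →
      zeros (n ℕ.+ i) (ℕ.m≤m+n n i) (subst (n ℕ.+ i <_) (ℕ.m+[n∸m]≡n n≤m) (ℕ.+-monoʳ-< n i<m∸n)))

  sumQ-swap : ∀ n m (F : ℕ → ℕ → ℚ) →
              sumQ n (λ i → sumQ m (λ j → F i j)) ≡ sumQ m (λ j → sumQ n (λ i → F i j))
  sumQ-swap zero    m F = sym (sumQ-vanish m _ (λ _ _ → refl))
  sumQ-swap (suc n) m F = trans (cong (_+ sumQ m (F n)) (sumQ-swap n m F))
    (sym (sumQ-+ m (λ j → sumQ n (λ i → F i j)) (F n)))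

  sumQ-swap₃ : ∀ N (F : ℕ → ℕ → ℕ → ℚ) →
    sumQ N (λ a → sumQ N (λ b → sumQ N (λ c → F a b c))) ≡
    sumQ N (λ b → sumQ N (λ c → sumQ N (λ a → F a b c)))
  sumQ-swap₃ N F = trans (sumQ-swap N N (λ a b → sumQ N (λ c → F a b c)))
    (sumQ-cong N (λ b → sumQ-swap N N (λ a c → F a b c)))

  sumQ-swap₄ : ∀ N (F : ℕ → ℕ → ℕ → ℕ → ℚ) →
    sumQ N (λ a → sumQ N (λ b → sumQ N (λ c → sumQ N (λ d → F a b c d)))) ≡
    sumQ N (λ c → sumQ N (λ d → sumQ N (λ b → sumQ N (λ a → F a b c d))))
  sumQ-swap₄ N F =
    trans (sumQ-cong N (λ a → sumQ-swap₃ N (λ b c d → F a b c d)))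
    (trans (sumQ-swap N N (λ a c → sumQ N (λ d → sumQ N (λ b → F a b c d))))
    (sumQ-cong N (λ c → sumQ-swap₃ N (λ a d b → F a b c d))))

  -- Spelled exactly like the indicator in monoS and substPow, so that both unfold to δ.
  δ : ℕ → ℕ → ℚ → ℚ
  δ a b x = if does (a ≟ b) then x else 0ℚ

  δ-refl : ∀ a x → δ a a x ≡ x
  δ-refl a x = cong (if_then x else 0ℚ) (dec-true (a ≟ a) refl)

  δ-≢ : ∀ {a b} x → ¬ a ≡ b → δ a b x ≡ 0ℚ
  δ-≢ {a} {b} x a≢b = cong (if_then x else 0ℚ) (dec-false (a ≟ b) a≢b)

  δ-0 : ∀ a b → δ a b 0ℚ ≡ 0ℚ
  δ-0 a b with a ≟ b
  ... | yes refl = δ-refl a 0ℚ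
  ... | no a≢b   = δ-≢ 0ℚ a≢b

  δ-⇔ : ∀ a b c d x → (a ≡ b → c ≡ d) → (c ≡ d → a ≡ b) → δ a b x ≡ δ c d x
  δ-⇔ a b c d x to from with a ≟ b
  ... | yes refl = trans (δ-refl a x) (sym (trans (cong (λ t → δ t d x) (to refl)) (δ-refl d x)))
  ... | no a≢b   = trans (δ-≢ x a≢b) (sym (δ-≢ x (λ c≡d → a≢b (from c≡d))))

  δ-sym : ∀ a b x → δ a b x ≡ δ b a x
  δ-sym a b x = δ-⇔ a b b a x sym sym

  δ-cong : ∀ a b {x y} → (a ≡ b → x ≡ y) → δ a b x ≡ δ a b y
  δ-cong a b {x} {y} e with a ≟ b
  ... | yes refl = trans (δ-refl a x) (trans (e refl) (sym (δ-refl a y)))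
  ... | no a≢b   = trans (δ-≢ x a≢b) (sym (δ-≢ y a≢b))

  δ-*ˡ : ∀ a b c x → c * δ a b x ≡ δ a b (c * x)
  δ-*ˡ a b c x with a ≟ b
  ... | yes refl = trans (cong (c *_) (δ-refl a x)) (sym (δ-refl a (c * x)))
  ... | no a≢b   = trans (cong (c *_) (δ-≢ x a≢b)) (trans (*-zeroʳ c) (sym (δ-≢ (c * x) a≢b)))

  δ-*ʳ : ∀ a b c x → δ a b x * c ≡ δ a b (x * c)
  δ-*ʳ a b c x = trans (*-comm _ c) (trans (δ-*ˡ a b c x) (δ-cong a b (λ _ → *-comm c x)))

  δ-δ : ∀ a b c d x → δ a b (δ c d x) ≡ δ c d (δ a b x)
  δ-δ a b c d x with a ≟ b
  ... | yes refl = trans (δ-refl a _) (δ-cong c d (λ _ → sym (δ-refl a x)))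
  ... | no a≢b   = trans (δ-≢ _ a≢b) (trans (sym (δ-0 c d)) (δ-cong c d (λ _ → sym (δ-≢ x a≢b))))

  δ-+ : ∀ a b x y → δ a b (x + y) ≡ δ a b x + δ a b y
  δ-+ a b x y with a ≟ b
  ... | yes refl = trans (δ-refl a _) (sym (cong₂ _+_ (δ-refl a x) (δ-refl a y)))
  ... | no a≢b   = trans (δ-≢ _ a≢b) (sym (cong₂ _+_ (δ-≢ x a≢b) (δ-≢ y a≢b)))

  δ-- : ∀ a b x y → δ a b (x - y) ≡ δ a b x - δ a b y
  δ-- a b x y with a ≟ b
  ... | yes refl = trans (δ-refl a _) (sym (cong₂ _-_ (δ-refl a x) (δ-refl a y)))
  ... | no a≢b   = trans (δ-≢ _ a≢b) (sym (cong₂ _-_ (δ-≢ x a≢b) (δ-≢ y a≢b)))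

  δ-sumQ : ∀ a b N (F : ℕ → ℚ) → δ a b (sumQ N F) ≡ sumQ N (λ i → δ a b (F i))
  δ-sumQ a b N F with a ≟ b
  ... | yes refl = trans (δ-refl a _) (sumQ-cong N (λ i → sym (δ-refl a (F i))))
  ... | no a≢b   = trans (δ-≢ _ a≢b) (sym (sumQ-vanish N _ (λ i _ → δ-≢ (F i) a≢b)))

  sumQ-δ : ∀ n k (x : ℕ → ℚ) → k < n → sumQ n (λ i → δ i k (x i)) ≡ x k
  sumQ-δ (suc n) k x k<1+n with ℕ.m<1+n⇒m<n∨m≡n k<1+n
  ... | inj₁ k<n  = trans (cong₂ _+_ (sumQ-δ n k x k<n) (δ-≢ (x n) (λ n≡k → ℕ.<-irrefl (sym n≡k) k<n)))
                          (+-identityʳ (x k))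
  ... | inj₂ refl = trans (cong₂ _+_ (sumQ-vanish n _ (λ i i<n → δ-≢ (x i) (λ i≡n → ℕ.<-irrefl i≡n i<n)))
                                     (δ-refl n (x n)))
                          (+-identityˡ (x n))

  sumQ-δ-complete : ∀ N m (x : ℕ → ℚ) → (N ≤ m → x m ≡ 0ℚ) → sumQ N (λ k → δ k m (x k)) ≡ x m
  sumQ-δ-complete N m x vanish with m ℕ.<? N
  ... | yes m<N = sumQ-δ N m x m<N
  ... | no m≮N  = trans (sumQ-vanish N _ (λ i i<N → δ-≢ (x i) (λ i≡m → ℕ.<-irrefl i≡m (ℕ.<-≤-trans i<N (ℕ.≮⇒≥ m≮N)))))
                        (sym (vanish (ℕ.≮⇒≥ m≮N)))

module PowerSeriesRing where

  open import Defs
  open import Data.Nat as ℕ using (ℕ; zero; suc; _≤_; _<_; _∸_; z≤n; s≤s)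
  import Data.Nat.Properties as ℕ
  open import Data.Rational using (ℚ; 0ℚ; 1ℚ; _+_; _*_; -_; _-_)
  open import Data.Rational.Properties
    using (+-identityˡ; +-identityʳ; +-inverseˡ; *-identityˡ; *-zeroˡ; *-zeroʳ;
           *-assoc; *-comm; *-distribˡ-+; *-distribʳ-+)
  open import Data.Rational.Solver using (module +-*-Solver)
  open import Relation.Binary.Bundles using (Setoid)
  import Relation.Binary.Reasoning.Setoid as SetoidReasoning
  open import Relation.Nullary using (¬_)
  open import Relation.Binary.PropositionalEquality
  open FiniteSums

  open +-*-Solver

  PS-setoid : Setoid _ _
  PS-setoid = record
    { Carrier       = PS
    ; _≈_           = _≗_
    ; isEquivalence = record
      { refl  = λ _ → refl
      ; sym   = λ e n → sym (e n)
      ; trans = λ e₁ e₂ n → trans (e₁ n) (e₂ n)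
      }
    }

  open Setoid PS-setoid public using () renaming (refl to ≗-refl; sym to ≗-sym; trans to ≗-trans)
  module ≗-Reasoning = SetoidReasoning PS-setoid

  mulS-cong-≤ : ∀ f f′ g g′ n → (∀ i → i ≤ n → f i ≡ f′ i) → (∀ i → i ≤ n → g i ≡ g′ i) →
                mulS f g n ≡ mulS f′ g′ n
  mulS-cong-≤ f f′ g g′ n ef eg = sumQ-cong-< (suc n) (λ i i<1+n → cong₂ _*_ (ef i (ℕ.≤-pred i<1+n)) (eg (n ∸ i) (ℕ.m∸n≤m n i)))

  mulS-cong : ∀ {f f′ g g′} → f ≗ f′ → g ≗ g′ → mulS f g ≗ mulS f′ g′
  mulS-cong {f} {f′} {g} {g′} ef eg n = mulS-cong-≤ f f′ g g′ n (λ i _ → ef i) (λ i _ → eg i)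

  mulS-congˡ : ∀ {f f′} g → f ≗ f′ → mulS f g ≗ mulS f′ g
  mulS-congˡ {f} {f′} g ef n = mulS-cong-≤ f f′ g g n (λ i _ → ef i) (λ _ _ → refl)

  mulS-congʳ : ∀ f {g g′} → g ≗ g′ → mulS f g ≗ mulS f g′
  mulS-congʳ f {g} {g′} eg n = mulS-cong-≤ f f g g′ n (λ _ _ → refl) (λ i _ → eg i)

  mulS-0 : ∀ f g → mulS f g 0 ≡ f 0 * g 0
  mulS-0 f g = +-identityˡ _

  -- Summing over a square instead of the antidiagonal lets the order of summation be changed freely.
  mulS-square : ∀ (f g : PS) n N → n < N → mulS f g n ≡ sumQ N (λ i → sumQ N (λ j → δ (i ℕ.+ j) n (f i * g j)))
  mulS-square f g n N n<N =
    trans (sumQ-cong-< (suc n) (λ i i<1+n → sym (row-on i (ℕ.≤-pred i<1+n))))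
          (sumQ-extend (suc n) N _ n<N (λ i n<i _ → row-off i n<i))
    where
    row-on : ∀ i → i ≤ n → sumQ N (λ j → δ (i ℕ.+ j) n (f i * g j)) ≡ f i * g (n ∸ i)
    row-on i i≤n =
      trans (sumQ-cong N (λ j → δ-⇔ (i ℕ.+ j) n j (n ∸ i) (f i * g j)
               (λ e → trans (sym (ℕ.m+n∸m≡n i j)) (cong (_∸ i) e))
               (λ e → trans (cong (i ℕ.+_) e) (ℕ.m+[n∸m]≡n i≤n))))
        (sumQ-δ N (n ∸ i) (λ j → f i * g j) (ℕ.≤-<-trans (ℕ.m∸n≤m n i) n<N))
    row-off : ∀ i → n < i → sumQ N (λ j → δ (i ℕ.+ j) n (f i * g j)) ≡ 0ℚ
    row-off i n<i = sumQ-vanish N _ (λ j _ → δ-≢ _ (λ e → ℕ.<-irrefl (sym e) (ℕ.<-≤-trans n<i (ℕ.m≤m+n i j))))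

  mulS-comm : ∀ f g → mulS f g ≗ mulS g f
  mulS-comm f g n = begin
    mulS f g n                                                         ≡⟨ mulS-square f g n (suc n) (ℕ.n<1+n n) ⟩
    sumQ (suc n) (λ i → sumQ (suc n) (λ j → δ (i ℕ.+ j) n (f i * g j))) ≡⟨ sumQ-swap (suc n) (suc n) _ ⟩
    sumQ (suc n) (λ j → sumQ (suc n) (λ i → δ (i ℕ.+ j) n (f i * g j))) ≡⟨ sumQ-cong (suc n) (λ j → sumQ-cong (suc n) (λ i → swap i j)) ⟩
    sumQ (suc n) (λ j → sumQ (suc n) (λ i → δ (j ℕ.+ i) n (g j * f i))) ≡⟨ mulS-square g f n (suc n) (ℕ.n<1+n n) ⟨
    mulS g f n                                                         ∎
    where
    open ≡-Reasoning
    swap : ∀ i j → δ (i ℕ.+ j) n (f i * g j) ≡ δ (j ℕ.+ i) n (g j * f i)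
    swap i j = trans (cong (λ t → δ t n (f i * g j)) (ℕ.+-comm i j)) (δ-cong (j ℕ.+ i) n (λ _ → *-comm (f i) (g j)))

  -- Both bracketings of a triple product are compared with this symmetric form.
  mulS₃ : PS → PS → PS → PS
  mulS₃ f g h n = sumQ (suc n) (λ i → sumQ (suc n) (λ j → sumQ (suc n) (λ l → δ (i ℕ.+ j ℕ.+ l) n (f i * g j * h l))))

  private
    sum-too-big : ∀ a b n → suc n ≤ a → ¬ (a ℕ.+ b ≡ n)
    sum-too-big a b n n<a e = ℕ.<-irrefl (sym e) (ℕ.<-≤-trans n<a (ℕ.m≤m+n a b))

  mulS-assocˡ : ∀ f g h n → mulS (mulS f g) h n ≡ mulS₃ f g h n
  mulS-assocˡ f g h n = begin
    mulS (mulS f g) h n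
      ≡⟨ mulS-square (mulS f g) h n N (ℕ.n<1+n n) ⟩
    sumQ N (λ k → sumQ N (λ l → δ (k ℕ.+ l) n (mulS f g k * h l)))
      ≡⟨ sumQ-cong-< N (λ k k<N → sumQ-cong N (λ l → expand k k<N l)) ⟩
    sumQ N (λ k → sumQ N (λ l → sumQ N (λ i → sumQ N (λ j → δ (k ℕ.+ l) n (δ (i ℕ.+ j) k (f i * g j) * h l)))))
      ≡⟨ sumQ-swap₄ N _ ⟩
    sumQ N (λ i → sumQ N (λ j → sumQ N (λ l → sumQ N (λ k → δ (k ℕ.+ l) n (δ (i ℕ.+ j) k (f i * g j) * h l)))))
      ≡⟨ sumQ-cong N (λ i → sumQ-cong N (λ j → sumQ-cong N (λ l → collapse i j l))) ⟩
    mulS₃ f g h n ∎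
    where
    open ≡-Reasoning
    N : ℕ
    N = suc n
    expand : ∀ k → k < N → ∀ l → δ (k ℕ.+ l) n (mulS f g k * h l) ≡
             sumQ N (λ i → sumQ N (λ j → δ (k ℕ.+ l) n (δ (i ℕ.+ j) k (f i * g j) * h l)))
    expand k k<N l = trans (cong (λ t → δ (k ℕ.+ l) n (t * h l)) (mulS-square f g k N k<N))
      (trans (cong (δ (k ℕ.+ l) n) (trans (sumQ-*ʳ N (h l) _) (sumQ-cong N (λ i → sumQ-*ʳ N (h l) _))))
      (trans (δ-sumQ (k ℕ.+ l) n N _) (sumQ-cong N (λ i → δ-sumQ (k ℕ.+ l) n N _))))
    collapse : ∀ i j l → sumQ N (λ k → δ (k ℕ.+ l) n (δ (i ℕ.+ j) k (f i * g j) * h l)) ≡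
               δ (i ℕ.+ j ℕ.+ l) n (f i * g j * h l)
    collapse i j l =
      trans (sumQ-cong N (λ k → trans (δ-cong (k ℕ.+ l) n (λ _ → δ-*ʳ (i ℕ.+ j) k (h l) (f i * g j)))
                               (trans (δ-δ (k ℕ.+ l) n (i ℕ.+ j) k _) (δ-sym (i ℕ.+ j) k _))))
            (sumQ-δ-complete N (i ℕ.+ j) (λ k → δ (k ℕ.+ l) n (f i * g j * h l))
               (λ N≤ → δ-≢ _ (sum-too-big (i ℕ.+ j) l n N≤)))

  mulS-assocʳ : ∀ f g h n → mulS f (mulS g h) n ≡ mulS₃ f g h n
  mulS-assocʳ f g h n = begin
    mulS f (mulS g h) n
      ≡⟨ mulS-square f (mulS g h) n N (ℕ.n<1+n n) ⟩
    sumQ N (λ i → sumQ N (λ m → δ (i ℕ.+ m) n (f i * mulS g h m)))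
      ≡⟨ sumQ-cong N (λ i → sumQ-cong-< N (λ m m<N → expand i m m<N)) ⟩
    sumQ N (λ i → sumQ N (λ m → sumQ N (λ j → sumQ N (λ l → δ (i ℕ.+ m) n (f i * δ (j ℕ.+ l) m (g j * h l))))))
      ≡⟨ sumQ-cong N (λ i → sumQ-swap₃ N _) ⟩
    sumQ N (λ i → sumQ N (λ j → sumQ N (λ l → sumQ N (λ m → δ (i ℕ.+ m) n (f i * δ (j ℕ.+ l) m (g j * h l))))))
      ≡⟨ sumQ-cong N (λ i → sumQ-cong N (λ j → sumQ-cong N (λ l → collapse i j l))) ⟩
    mulS₃ f g h n ∎
    where
    open ≡-Reasoning
    N : ℕ
    N = suc n
    expand : ∀ i m → m < N → δ (i ℕ.+ m) n (f i * mulS g h m) ≡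
             sumQ N (λ j → sumQ N (λ l → δ (i ℕ.+ m) n (f i * δ (j ℕ.+ l) m (g j * h l))))
    expand i m m<N = trans (cong (λ t → δ (i ℕ.+ m) n (f i * t)) (mulS-square g h m N m<N))
      (trans (cong (δ (i ℕ.+ m) n) (trans (sumQ-*ˡ N (f i) _) (sumQ-cong N (λ j → sumQ-*ˡ N (f i) _))))
      (trans (δ-sumQ (i ℕ.+ m) n N _) (sumQ-cong N (λ j → δ-sumQ (i ℕ.+ m) n N _))))
    collapse : ∀ i j l → sumQ N (λ m → δ (i ℕ.+ m) n (f i * δ (j ℕ.+ l) m (g j * h l))) ≡
               δ (i ℕ.+ j ℕ.+ l) n (f i * g j * h l)
    collapse i j l =
      trans (sumQ-cong N (λ m → trans (δ-cong (i ℕ.+ m) n (λ _ → δ-*ˡ (j ℕ.+ l) m (f i) (g j * h l)))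
                               (trans (δ-δ (i ℕ.+ m) n (j ℕ.+ l) m _) (δ-sym (j ℕ.+ l) m _))))
      (trans (sumQ-δ-complete N (j ℕ.+ l) (λ m → δ (i ℕ.+ m) n (f i * (g j * h l)))
               (λ N≤ → δ-≢ _ (λ e → sum-too-big (j ℕ.+ l) i n N≤ (trans (ℕ.+-comm (j ℕ.+ l) i) e))))
      (trans (δ-⇔ (i ℕ.+ (j ℕ.+ l)) n (i ℕ.+ j ℕ.+ l) n _ (trans (ℕ.+-assoc i j l)) (trans (sym (ℕ.+-assoc i j l))))
             (δ-cong (i ℕ.+ j ℕ.+ l) n (λ _ → sym (*-assoc (f i) (g j) (h l))))))

  mulS-assoc : ∀ f g h → mulS (mulS f g) h ≗ mulS f (mulS g h)
  mulS-assoc f g h n = trans (mulS-assocˡ f g h n) (sym (mulS-assocʳ f g h n))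

  mulS-distribˡ : ∀ f g h → mulS f (addS g h) ≗ addS (mulS f g) (mulS f h)
  mulS-distribˡ f g h n = trans (sumQ-cong (suc n) (λ i → *-distribˡ-+ (f i) (g (n ∸ i)) (h (n ∸ i)))) (sumQ-+ (suc n) _ _)

  mulS-distribʳ : ∀ f g h → mulS (addS f g) h ≗ addS (mulS f h) (mulS g h)
  mulS-distribʳ f g h n = trans (sumQ-cong (suc n) (λ i → *-distribʳ-+ (h (n ∸ i)) (f i) (g i))) (sumQ-+ (suc n) _ _)

  mulS-subˡ : ∀ f g h → mulS (subS f g) h ≗ subS (mulS f h) (mulS g h)
  mulS-subˡ f g h n = trans (sumQ-cong (suc n) (λ i → solve 3 (λ a b c → (a :- b) :* c := a :* c :- b :* c) refl (f i) (g i) (h (n ∸ i))))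
                            (sumQ-- (suc n) _ _)

  mulS-subʳ : ∀ f g h → mulS f (subS g h) ≗ subS (mulS f g) (mulS f h)
  mulS-subʳ f g h n = trans (mulS-comm f (subS g h) n) (trans (mulS-subˡ g h f n) (cong₂ _-_ (mulS-comm g f n) (mulS-comm h f n)))

  mulS-scaleˡ : ∀ c f g → mulS (scaleS c f) g ≗ scaleS c (mulS f g)
  mulS-scaleˡ c f g n = trans (sumQ-cong (suc n) (λ i → *-assoc c (f i) (g (n ∸ i)))) (sym (sumQ-*ˡ (suc n) c _))

  mulS-scaleʳ : ∀ c f g → mulS f (scaleS c g) ≗ scaleS c (mulS f g)
  mulS-scaleʳ c f g n = trans (mulS-comm f (scaleS c g) n) (trans (mulS-scaleˡ c g f n) (cong (c *_) (mulS-comm g f n)))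

  mulS-identityˡ : ∀ g → mulS oneS g ≗ g
  mulS-identityˡ g n = trans (sumQ-head n _)
    (trans (cong₂ _+_ (*-identityˡ (g n)) (sumQ-vanish n _ (λ i _ → *-zeroˡ (g (n ∸ suc i))))) (+-identityʳ (g n)))

  mulS-identityʳ : ∀ g → mulS g oneS ≗ g
  mulS-identityʳ g n = trans (mulS-comm g oneS n) (mulS-identityˡ g n)

  mulS-zeroˡ : ∀ g → mulS zeroS g ≗ zeroS
  mulS-zeroˡ g n = sumQ-vanish (suc n) _ (λ i _ → *-zeroˡ (g (n ∸ i)))

  mulS-zeroʳ : ∀ f → mulS f zeroS ≗ zeroS
  mulS-zeroʳ f n = sumQ-vanish (suc n) _ (λ i _ → *-zeroʳ (f i))

  mulS-sumS : ∀ f K (G : ℕ → PS) → mulS f (sumS K G) ≗ sumS K (λ k → mulS f (G k))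
  mulS-sumS f zero    G = mulS-zeroʳ f
  mulS-sumS f (suc K) G n = trans (mulS-distribˡ f (sumS K G) (G K) n) (cong (_+ mulS f (G K) n) (mulS-sumS f K G n))

  mulS-vanish : ∀ f g n → (∀ i → i ≤ n → f i ≡ 0ℚ) → mulS f g n ≡ 0ℚ
  mulS-vanish f g n zeros =
    sumQ-vanish (suc n) _ (λ i i<1+n → trans (cong (_* g (n ∸ i)) (zeros i (ℕ.≤-pred i<1+n))) (*-zeroˡ (g (n ∸ i))))

  mulS-swapˡ : ∀ f g h → mulS f (mulS g h) ≗ mulS g (mulS f h)
  mulS-swapˡ f g h = ≗-trans (≗-sym (mulS-assoc f g h)) (≗-trans (mulS-congˡ h (mulS-comm f g)) (mulS-assoc g f h))

  shiftS-mulSˡ : ∀ f g → mulS (shiftS f) g ≗ shiftS (mulS f g)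
  shiftS-mulSˡ f g zero    = trans (mulS-0 (shiftS f) g) (*-zeroˡ (g 0))
  shiftS-mulSˡ f g (suc n) = trans (sumQ-head (suc n) (λ i → shiftS f i * g (suc n ∸ i)))
    (trans (cong (_+ mulS f g n) (*-zeroˡ (g (suc n)))) (+-identityˡ (mulS f g n)))

  powS-cong : ∀ {f g} k → f ≗ g → powS f k ≗ powS g k
  powS-cong zero    e = ≗-refl
  powS-cong (suc k) e = mulS-cong e (powS-cong k e)

  powS-scaleS : ∀ c f k → powS (scaleS c f) k ≗ scaleS (powQ c k) (powS f k)
  powS-scaleS c f zero    n = sym (*-identityˡ (oneS n))
  powS-scaleS c f (suc k) n = begin
    mulS (scaleS c f) (powS (scaleS c f) k) n               ≡⟨ mulS-congʳ (scaleS c f) (powS-scaleS c f k) n ⟩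
    mulS (scaleS c f) (scaleS (powQ c k) (powS f k)) n      ≡⟨ mulS-scaleˡ c f (scaleS (powQ c k) (powS f k)) n ⟩
    c * mulS f (scaleS (powQ c k) (powS f k)) n             ≡⟨ cong (c *_) (mulS-scaleʳ (powQ c k) f (powS f k) n) ⟩
    c * (powQ c k * mulS f (powS f k) n)                    ≡⟨ *-assoc c (powQ c k) _ ⟨
    c * powQ c k * mulS f (powS f k) n                      ∎
    where open ≡-Reasoning

  powS-oneS : ∀ k → powS oneS k ≗ oneS
  powS-oneS zero    = ≗-refl
  powS-oneS (suc k) = ≗-trans (mulS-congʳ oneS (powS-oneS k)) (mulS-identityˡ oneS)

  powS-0 : ∀ f k → powS f k 0 ≡ powQ (f 0) k
  powS-0 f zero    = refl
  powS-0 f (suc k) = trans (mulS-0 f (powS f k)) (cong (f 0 *_) (powS-0 f k))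

  powS-vanish : ∀ f k n → f 0 ≡ 0ℚ → n < k → powS f k n ≡ 0ℚ
  powS-vanish f (suc k) n f0≡0 n<1+k = sumQ-vanish (suc n) _ term
    where
    term : ∀ i → i < suc n → f i * powS f k (n ∸ i) ≡ 0ℚ
    term zero    _     = trans (cong (_* powS f k n) f0≡0) (*-zeroˡ (powS f k n))
    term (suc i) i<1+n = trans (cong (f (suc i) *_) (powS-vanish f k (n ∸ suc i) f0≡0
      (ℕ.<-≤-trans (ℕ.∸-monoʳ-< (s≤s z≤n) (ℕ.≤-pred i<1+n)) (ℕ.≤-pred n<1+k)))) (*-zeroʳ (f (suc i)))

  invS-rec : ∀ f n → invS f (suc n) ≡ - sumQ (suc n) (λ j → f (suc j) * invS f (n ∸ j))
  invS-rec = via-lookup _ (λ _ → refl) (λ _ _ → refl) (λ _ _ _ → refl) (λ _ _ → refl)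
    where
    -- The lookup into invList is private; it enters as K and is found by unification.
    via-lookup : (K : PS → ℕ → ℕ → ℚ) →
                 (∀ f → K f 0 0 ≡ invS f 0) → (∀ f n → K f (suc n) 0 ≡ invS f (suc n)) →
                 (∀ f n j → K f (suc n) (suc j) ≡ K f n j) →
                 (∀ f n → invS f (suc n) ≡ - sumQ (suc n) (λ j → f (suc j) * K f n j)) →
                 ∀ f n → invS f (suc n) ≡ - sumQ (suc n) (λ j → f (suc j) * invS f (n ∸ j))
    via-lookup K K00 K-suc0 K-suc-suc rec f n =
      trans (rec f n) (cong (λ t → - t) (sumQ-cong-< (suc n) (λ j j<1+n → cong (f (suc j) *_) (K≡invS n j (ℕ.≤-pred j<1+n)))))
      where
      K≡invS : ∀ n j → j ≤ n → K f n j ≡ invS f (n ∸ j)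
      K≡invS zero    zero    _         = K00 f
      K≡invS (suc n) zero    _         = K-suc0 f n
      K≡invS (suc n) (suc j) (s≤s j≤n) = trans (K-suc-suc f n j) (K≡invS n j j≤n)

  invS-inverseʳ : ∀ f → f 0 ≡ 1ℚ → mulS f (invS f) ≗ oneS
  invS-inverseʳ f f0≡1 zero    = trans (mulS-0 f (invS f)) (trans (cong (_* 1ℚ) f0≡1) refl)
  invS-inverseʳ f f0≡1 (suc n) = begin
    mulS f (invS f) (suc n)                              ≡⟨ sumQ-head (suc n) (λ i → f i * invS f (suc n ∸ i)) ⟩
    f 0 * invS f (suc n) + S                             ≡⟨ cong₂ _+_ (trans (cong (_* invS f (suc n)) f0≡1) (*-identityˡ (invS f (suc n)))) (refl {x = S}) ⟩
    invS f (suc n) + S                                   ≡⟨ cong₂ _+_ (invS-rec f n) (refl {x = S}) ⟩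
    - S + S                                              ≡⟨ +-inverseˡ S ⟩
    0ℚ                                                   ∎
    where
    open ≡-Reasoning
    S : ℚ
    S = sumQ (suc n) (λ j → f (suc j) * invS f (n ∸ j))

  mulS-cancelˡ : ∀ f {g h} → f 0 ≡ 1ℚ → mulS f g ≗ mulS f h → g ≗ h
  mulS-cancelˡ f {g} {h} f0≡1 e = ≗-trans (≗-sym (undo g)) (≗-trans (mulS-congʳ (invS f) e) (undo h))
    where
    undo : ∀ k → mulS (invS f) (mulS f k) ≗ k
    undo k = ≗-trans (≗-sym (mulS-assoc (invS f) f k))
      (≗-trans (mulS-congˡ k (≗-trans (mulS-comm (invS f) f) (invS-inverseʳ f f0≡1))) (mulS-identityˡ k))

module Substitution where

  open import Defs
  open import Data.Nat as ℕ using (ℕ; zero; suc; _≤_; _<_; _∸_; s≤s; NonZero)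
  import Data.Nat.Properties as ℕ
  open import Data.Rational using (0ℚ; 1ℚ; _+_; _*_)
  open import Data.Rational.Properties using (+-identityˡ)
  open import Relation.Nullary using (¬_; yes; no)
  open import Relation.Binary.PropositionalEquality
  open FiniteSums
  open PowerSeriesRing

  shiftBy : ℕ → PS → PS
  shiftBy zero    f = f
  shiftBy (suc k) f = shiftS (shiftBy k f)

  shiftBy-< : ∀ k f n → n < k → shiftBy k f n ≡ 0ℚ
  shiftBy-< (suc k) f zero    _         = refl
  shiftBy-< (suc k) f (suc n) (s≤s n<k) = shiftBy-< k f n n<k

  shiftBy-+ : ∀ k f m → shiftBy k f (k ℕ.+ m) ≡ f m
  shiftBy-+ zero    f m = refl
  shiftBy-+ (suc k) f m = shiftBy-+ k f m

  shiftS-cong : ∀ {f g} → f ≗ g → shiftS f ≗ shiftS g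
  shiftS-cong e zero    = refl
  shiftS-cong e (suc n) = e n

  mulS-shiftByʳ : ∀ k f g → mulS f (shiftBy k g) ≗ shiftBy k (mulS f g)
  mulS-shiftByʳ zero    f g = ≗-refl
  mulS-shiftByʳ (suc k) f g = ≗-trans (mulS-comm f (shiftBy (suc k) g)) (≗-trans (shiftS-mulSˡ (shiftBy k g) f)
    (shiftS-cong (≗-trans (mulS-comm (shiftBy k g) f) (mulS-shiftByʳ k f g))))

  powS-shiftS : ∀ g k → powS (shiftS g) k ≗ shiftBy k (powS g k)
  powS-shiftS g zero    = ≗-refl
  powS-shiftS g (suc k) = ≗-trans (mulS-congʳ (shiftS g) (powS-shiftS g k)) (≗-trans (shiftS-mulSˡ g (shiftBy k (powS g k)))
    (shiftS-cong (mulS-shiftByʳ k g (powS g k))))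

  substPow-0 : ∀ d f → substPow d f 0 ≡ f 0
  substPow-0 d f = trans (+-identityˡ _) (trans (δ-⇔ (d ℕ.* 0) 0 0 0 (f 0) (λ _ → refl) (λ _ → ℕ.*-zeroʳ d)) (δ-refl 0 (f 0)))

  substPow-cong : ∀ d {f g} → f ≗ g → substPow d f ≗ substPow d g
  substPow-cong d e n = sumQ-cong (suc n) (λ i → δ-cong (d ℕ.* i) n (λ _ → e i))

  substPow-addS : ∀ d f g → substPow d (addS f g) ≗ addS (substPow d f) (substPow d g)
  substPow-addS d f g n = trans (sumQ-cong (suc n) (λ i → δ-+ (d ℕ.* i) n (f i) (g i))) (sumQ-+ (suc n) _ _)

  substPow-subS : ∀ d f g → substPow d (subS f g) ≗ subS (substPow d f) (substPow d g)
  substPow-subS d f g n = trans (sumQ-cong (suc n) (λ i → δ-- (d ℕ.* i) n (f i) (g i))) (sumQ-- (suc n) _ _)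

  substPow-scaleS : ∀ d c f → substPow d (scaleS c f) ≗ scaleS c (substPow d f)
  substPow-scaleS d c f n = trans (sumQ-cong (suc n) (λ i → sym (δ-*ˡ (d ℕ.* i) n c (f i)))) (sym (sumQ-*ˡ (suc n) c _))

  module _ (d : ℕ) .{{_ : NonZero d}} where

    private
      too-big : ∀ {n i} → n < i → ¬ (d ℕ.* i ≡ n)
      too-big {n} {i} n<i e = ℕ.<-irrefl (sym e) (ℕ.<-≤-trans n<i (ℕ.m≤n*m i d))

    substPow-extend : ∀ f n N → n < N → substPow d f n ≡ sumQ N (λ i → δ (d ℕ.* i) n (f i))
    substPow-extend f n N n<N = sumQ-extend (suc n) N _ n<N (λ i n<i _ → δ-≢ (f i) (too-big n<i))

    substPow-oneS : substPow d oneS ≗ oneS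
    substPow-oneS zero    = substPow-0 d oneS
    substPow-oneS (suc n) = sumQ-vanish (suc (suc n)) _ term
      where
      term : ∀ i → i < suc (suc n) → δ (d ℕ.* i) (suc n) (oneS i) ≡ 0ℚ
      term zero    _ = δ-≢ 1ℚ (λ e → ℕ.0≢1+n (trans (sym (ℕ.*-zeroʳ d)) e))
      term (suc i) _ = δ-0 (d ℕ.* suc i) (suc n)

    substPow-mulS-square : ∀ f g n → substPow d (mulS f g) n ≡
                           sumQ (suc n) (λ a → sumQ (suc n) (λ b → δ (d ℕ.* (a ℕ.+ b)) n (f a * g b)))
    substPow-mulS-square f g n = begin
      sumQ N (λ i → δ (d ℕ.* i) n (mulS f g i))
        ≡⟨ sumQ-cong-< N (λ i i<N → trans (cong (δ (d ℕ.* i) n) (mulS-square f g i N i<N))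
             (trans (δ-sumQ (d ℕ.* i) n N _) (sumQ-cong N (λ a → δ-sumQ (d ℕ.* i) n N _)))) ⟩
      sumQ N (λ i → sumQ N (λ a → sumQ N (λ b → δ (d ℕ.* i) n (δ (a ℕ.+ b) i (f a * g b)))))
        ≡⟨ sumQ-swap₃ N _ ⟩
      sumQ N (λ a → sumQ N (λ b → sumQ N (λ i → δ (d ℕ.* i) n (δ (a ℕ.+ b) i (f a * g b)))))
        ≡⟨ sumQ-cong N (λ a → sumQ-cong N (λ b → collapse a b)) ⟩
      sumQ N (λ a → sumQ N (λ b → δ (d ℕ.* (a ℕ.+ b)) n (f a * g b))) ∎
      where
      open ≡-Reasoning
      N : ℕ
      N = suc n
      collapse : ∀ a b → sumQ N (λ i → δ (d ℕ.* i) n (δ (a ℕ.+ b) i (f a * g b))) ≡ δ (d ℕ.* (a ℕ.+ b)) n (f a * g b)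
      collapse a b = trans (sumQ-cong N (λ i → trans (δ-δ (d ℕ.* i) n (a ℕ.+ b) i _) (δ-sym (a ℕ.+ b) i _)))
        (sumQ-δ-complete N (a ℕ.+ b) (λ i → δ (d ℕ.* i) n (f a * g b)) (λ N≤ → δ-≢ _ (too-big N≤)))

    mulS-substPow-square : ∀ f g n → mulS (substPow d f) (substPow d g) n ≡
                           sumQ (suc n) (λ a → sumQ (suc n) (λ b → δ (d ℕ.* (a ℕ.+ b)) n (f a * g b)))
    mulS-substPow-square f g n = begin
      mulS (substPow d f) (substPow d g) n
        ≡⟨ mulS-square (substPow d f) (substPow d g) n N (ℕ.n<1+n n) ⟩
      sumQ N (λ k → sumQ N (λ l → δ (k ℕ.+ l) n (substPow d f k * substPow d g l)))
        ≡⟨ sumQ-cong-< N (λ k k<N → sumQ-cong-< N (λ l l<N → expand k l k<N l<N)) ⟩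
      sumQ N (λ k → sumQ N (λ l → sumQ N (λ a → sumQ N (λ b → δ (k ℕ.+ l) n (δ (d ℕ.* a) k (f a) * δ (d ℕ.* b) l (g b))))))
        ≡⟨ sumQ-swap₄ N _ ⟩
      sumQ N (λ a → sumQ N (λ b → sumQ N (λ l → sumQ N (λ k → δ (k ℕ.+ l) n (δ (d ℕ.* a) k (f a) * δ (d ℕ.* b) l (g b))))))
        ≡⟨ sumQ-cong N (λ a → sumQ-cong N (λ b → collapse a b)) ⟩
      sumQ N (λ a → sumQ N (λ b → δ (d ℕ.* (a ℕ.+ b)) n (f a * g b))) ∎
      where
      open ≡-Reasoning
      N : ℕ
      N = suc n
      expand : ∀ k l → k < N → l < N → δ (k ℕ.+ l) n (substPow d f k * substPow d g l) ≡
               sumQ N (λ a → sumQ N (λ b → δ (k ℕ.+ l) n (δ (d ℕ.* a) k (f a) * δ (d ℕ.* b) l (g b))))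
      expand k l k<N l<N = trans (cong (δ (k ℕ.+ l) n)
          (trans (cong₂ _*_ (substPow-extend f k N k<N) (substPow-extend g l N l<N))
          (trans (sumQ-*ʳ N _ (λ a → δ (d ℕ.* a) k (f a))) (sumQ-cong N (λ a → sumQ-*ˡ N (δ (d ℕ.* a) k (f a)) _)))))
        (trans (δ-sumQ (k ℕ.+ l) n N _) (sumQ-cong N (λ a → δ-sumQ (k ℕ.+ l) n N _)))
      not-n : ∀ m l → N ≤ m → ¬ (m ℕ.+ l ≡ n)
      not-n m l N≤m e = ℕ.<-irrefl (sym e) (ℕ.<-≤-trans N≤m (ℕ.m≤m+n m l))
      collapse : ∀ a b → sumQ N (λ l → sumQ N (λ k → δ (k ℕ.+ l) n (δ (d ℕ.* a) k (f a) * δ (d ℕ.* b) l (g b)))) ≡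
                 δ (d ℕ.* (a ℕ.+ b)) n (f a * g b)
      collapse a b = begin
        sumQ N (λ l → sumQ N (λ k → δ (k ℕ.+ l) n (δ (d ℕ.* a) k (f a) * δ (d ℕ.* b) l (g b))))
          ≡⟨ sumQ-cong N (λ l → trans (sumQ-cong N (λ k →
                trans (δ-cong (k ℕ.+ l) n (λ _ → δ-*ʳ (d ℕ.* a) k (δ (d ℕ.* b) l (g b)) (f a)))
                (trans (δ-δ (k ℕ.+ l) n (d ℕ.* a) k _) (δ-sym (d ℕ.* a) k _))))
              (sumQ-δ-complete N (d ℕ.* a) (λ k → δ (k ℕ.+ l) n (f a * δ (d ℕ.* b) l (g b)))
                 (λ N≤ → δ-≢ _ (not-n (d ℕ.* a) l N≤)))) ⟩
        sumQ N (λ l → δ (d ℕ.* a ℕ.+ l) n (f a * δ (d ℕ.* b) l (g b)))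
          ≡⟨ sumQ-cong N (λ l → trans (δ-cong (d ℕ.* a ℕ.+ l) n (λ _ → δ-*ˡ (d ℕ.* b) l (f a) (g b)))
                (trans (δ-δ (d ℕ.* a ℕ.+ l) n (d ℕ.* b) l _) (δ-sym (d ℕ.* b) l _))) ⟩
        sumQ N (λ l → δ l (d ℕ.* b) (δ (d ℕ.* a ℕ.+ l) n (f a * g b)))
          ≡⟨ sumQ-δ-complete N (d ℕ.* b) (λ l → δ (d ℕ.* a ℕ.+ l) n (f a * g b))
               (λ N≤ → δ-≢ _ (λ e → not-n (d ℕ.* b) (d ℕ.* a) N≤ (trans (ℕ.+-comm (d ℕ.* b) (d ℕ.* a)) e))) ⟩
        δ (d ℕ.* a ℕ.+ d ℕ.* b) n (f a * g b)
          ≡⟨ δ-⇔ (d ℕ.* a ℕ.+ d ℕ.* b) n (d ℕ.* (a ℕ.+ b)) n (f a * g b)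
               (trans (ℕ.*-distribˡ-+ d a b)) (trans (sym (ℕ.*-distribˡ-+ d a b))) ⟩
        δ (d ℕ.* (a ℕ.+ b)) n (f a * g b) ∎

    substPow-mulS : ∀ f g → substPow d (mulS f g) ≗ mulS (substPow d f) (substPow d g)
    substPow-mulS f g n = trans (substPow-mulS-square f g n) (sym (mulS-substPow-square f g n))

    substPow-powS : ∀ f k → substPow d (powS f k) ≗ powS (substPow d f) k
    substPow-powS f zero    = substPow-oneS
    substPow-powS f (suc k) = ≗-trans (substPow-mulS f (powS f k)) (mulS-congʳ (substPow d f) (substPow-powS f k))

    substPow-shiftS : ∀ g → substPow d (shiftS g) ≗ shiftBy d (substPow d g)
    substPow-shiftS g n with n ℕ.<? d
    ... | yes n<d = trans (sumQ-vanish (suc n) _ term) (sym (shiftBy-< d _ n n<d))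
      where
      term : ∀ i → i < suc n → δ (d ℕ.* i) n (shiftS g i) ≡ 0ℚ
      term zero    _ = δ-0 (d ℕ.* 0) n
      term (suc i) _ = δ-≢ _ (λ e → ℕ.<-irrefl (sym e) (ℕ.<-≤-trans n<d (ℕ.m≤m*n d (suc i))))
    ... | no n≮d = subst (λ t → substPow d (shiftS g) t ≡ shiftBy d (substPow d g) t) (ℕ.m+[n∸m]≡n (ℕ.≮⇒≥ n≮d))
                         (above (n ∸ d))
      where
      above : ∀ m → substPow d (shiftS g) (d ℕ.+ m) ≡ shiftBy d (substPow d g) (d ℕ.+ m)
      above m = begin
        sumQ (suc (d ℕ.+ m)) (λ i → δ (d ℕ.* i) (d ℕ.+ m) (shiftS g i))
          ≡⟨ sumQ-head (d ℕ.+ m) _ ⟩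
        δ (d ℕ.* 0) (d ℕ.+ m) 0ℚ + sumQ (d ℕ.+ m) (λ i → δ (d ℕ.* suc i) (d ℕ.+ m) (g i))
          ≡⟨ cong₂ _+_ (δ-0 (d ℕ.* 0) (d ℕ.+ m)) (sumQ-cong (d ℕ.+ m) (λ i → δ-⇔ (d ℕ.* suc i) (d ℕ.+ m) (d ℕ.* i) m (g i)
                (λ e → ℕ.+-cancelˡ-≡ d _ _ (trans (sym (ℕ.*-suc d i)) e)) (λ e → trans (ℕ.*-suc d i) (cong (d ℕ.+_) e)))) ⟩
        0ℚ + sumQ (d ℕ.+ m) (λ i → δ (d ℕ.* i) m (g i))
          ≡⟨ +-identityˡ _ ⟩
        sumQ (d ℕ.+ m) (λ i → δ (d ℕ.* i) m (g i))
          ≡⟨ substPow-extend g m (d ℕ.+ m) (ℕ.+-monoˡ-≤ m (ℕ.>-nonZero⁻¹ d)) ⟨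
        substPow d g m
          ≡⟨ shiftBy-+ d (substPow d g) m ⟨
        shiftBy d (substPow d g) (d ℕ.+ m) ∎
        where open ≡-Reasoning

module Derivation where

  open import Defs
  open import Data.Nat as ℕ using (ℕ; zero; suc; _≤_; _<_; _∸_; s≤s)
  import Data.Nat.Properties as ℕ
  open import Data.Nat.Induction using (<-rec)
  open import Data.Rational using (ℚ; 0ℚ; 1ℚ; _+_; _*_)
  open import Data.Rational.Properties
    using (+-identityˡ; +-identityʳ; *-zeroˡ; *-zeroʳ; *-identityˡ; *-assoc; *-distribˡ-+; *-distribʳ-+)
  open import Data.Rational.Solver using (module +-*-Solver)
  open import Relation.Binary.PropositionalEquality
  open RationalArithmetic
  open FiniteSums
  open PowerSeriesRing

  open +-*-Solver

  deriv : PS → PS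
  deriv f n = ℕtoℚ (suc n) * f (suc n)

  deriv-addS : ∀ f g → deriv (addS f g) ≗ addS (deriv f) (deriv g)
  deriv-addS f g n = *-distribˡ-+ (ℕtoℚ (suc n)) (f (suc n)) (g (suc n))

  deriv-subS : ∀ f g → deriv (subS f g) ≗ subS (deriv f) (deriv g)
  deriv-subS f g n = solve 3 (λ k x y → k :* (x :- y) := k :* x :- k :* y) refl (ℕtoℚ (suc n)) (f (suc n)) (g (suc n))

  deriv-scaleS : ∀ c f → deriv (scaleS c f) ≗ scaleS c (deriv f)
  deriv-scaleS c f n = solve 3 (λ k c x → k :* (c :* x) := c :* (k :* x)) refl (ℕtoℚ (suc n)) c (f (suc n))

  deriv-sumS : ∀ K (G : ℕ → PS) → deriv (sumS K G) ≗ sumS K (λ k → deriv (G k))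
  deriv-sumS K G n = sumQ-*ˡ K (ℕtoℚ (suc n)) (λ i → G i (suc n))

  deriv-oneS : deriv oneS ≗ zeroS
  deriv-oneS n = *-zeroʳ (ℕtoℚ (suc n))

  -- Write n+1 = i + (n+1-i) in the i-th term; the weight i kills the term i = 0 of the first
  -- resulting sum and the weight n+1-i kills the term i = n+1 of the second.
  antidiagonal-weight-split : ∀ n (β : ℕ → ℕ → ℚ) →
    ℕtoℚ (suc n) * sumQ (suc (suc n)) (λ i → β i (suc n ∸ i)) ≡
    sumQ (suc n) (λ i → ℕtoℚ (suc i) * β (suc i) (n ∸ i)) + sumQ (suc n) (λ i → ℕtoℚ (suc n ∸ i) * β i (suc n ∸ i))
  antidiagonal-weight-split n β = begin
    ℕtoℚ (suc n) * sumQ (suc (suc n)) (λ i → β i (suc n ∸ i))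
      ≡⟨ sumQ-*ˡ (suc (suc n)) (ℕtoℚ (suc n)) _ ⟩
    sumQ (suc (suc n)) (λ i → ℕtoℚ (suc n) * β i (suc n ∸ i))
      ≡⟨ sumQ-cong-< (suc (suc n)) (λ i i<n+2 → split-weight i (ℕ.≤-pred i<n+2)) ⟩
    sumQ (suc (suc n)) (λ i → ℕtoℚ i * β i (suc n ∸ i) + ℕtoℚ (suc n ∸ i) * β i (suc n ∸ i))
      ≡⟨ sumQ-+ (suc (suc n)) _ _ ⟩
    sumQ (suc (suc n)) (λ i → ℕtoℚ i * β i (suc n ∸ i)) + sumQ (suc (suc n)) (λ i → ℕtoℚ (suc n ∸ i) * β i (suc n ∸ i))
      ≡⟨ cong₂ _+_ drop-first drop-last ⟩
    sumQ (suc n) (λ i → ℕtoℚ (suc i) * β (suc i) (n ∸ i)) + sumQ (suc n) (λ i → ℕtoℚ (suc n ∸ i) * β i (suc n ∸ i)) ∎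
    where
    open ≡-Reasoning
    split-weight : ∀ i → i ≤ suc n →
                   ℕtoℚ (suc n) * β i (suc n ∸ i) ≡ ℕtoℚ i * β i (suc n ∸ i) + ℕtoℚ (suc n ∸ i) * β i (suc n ∸ i)
    split-weight i i≤n+1 = trans (cong (λ t → ℕtoℚ t * β i (suc n ∸ i)) (sym (ℕ.m+[n∸m]≡n i≤n+1)))
      (trans (cong (_* β i (suc n ∸ i)) (ℕtoℚ-+ i (suc n ∸ i))) (*-distribʳ-+ (β i (suc n ∸ i)) (ℕtoℚ i) (ℕtoℚ (suc n ∸ i))))
    drop-first : sumQ (suc (suc n)) (λ i → ℕtoℚ i * β i (suc n ∸ i)) ≡ sumQ (suc n) (λ i → ℕtoℚ (suc i) * β (suc i) (n ∸ i))
    drop-first = trans (sumQ-head (suc n) _) (trans (cong (_+ R) (*-zeroˡ (β 0 (suc n)))) (+-identityˡ R))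
      where R = sumQ (suc n) (λ i → ℕtoℚ (suc i) * β (suc i) (n ∸ i))
    drop-last : sumQ (suc (suc n)) (λ i → ℕtoℚ (suc n ∸ i) * β i (suc n ∸ i)) ≡ sumQ (suc n) (λ i → ℕtoℚ (suc n ∸ i) * β i (suc n ∸ i))
    drop-last = trans (cong (sumQ (suc n) (λ i → ℕtoℚ (suc n ∸ i) * β i (suc n ∸ i)) +_)
                            (trans (cong (λ t → ℕtoℚ t * β (suc n) t) (ℕ.n∸n≡0 (suc n))) (*-zeroˡ (β (suc n) 0))))
                      (+-identityʳ _)

  deriv-mulS : ∀ f g → deriv (mulS f g) ≗ addS (mulS (deriv f) g) (mulS f (deriv g))
  deriv-mulS f g n = trans (antidiagonal-weight-split n (λ i k → f i * g k))
    (cong₂ _+_ (sumQ-cong (suc n) (λ i → sym (*-assoc (ℕtoℚ (suc i)) (f (suc i)) (g (n ∸ i)))))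
               (sumQ-cong-< (suc n) (λ i i<1+n → trans
                 (solve 3 (λ k x y → k :* (x :* y) := x :* (k :* y)) refl (ℕtoℚ (suc n ∸ i)) (f i) (g (suc n ∸ i)))
                 (cong (λ t → f i * (ℕtoℚ t * g t)) (ℕ.+-∸-assoc 1 (ℕ.≤-pred i<1+n))))))

  deriv-powS : ∀ g j → deriv (powS g (suc j)) ≗ scaleS (ℕtoℚ (suc j)) (mulS (powS g j) (deriv g))
  deriv-powS g zero n = begin
    deriv (mulS g oneS) n                              ≡⟨ deriv-mulS g oneS n ⟩
    mulS (deriv g) oneS n + mulS g (deriv oneS) n      ≡⟨ cong₂ _+_ (mulS-identityʳ (deriv g) n)
                                                                 (trans (mulS-congʳ g deriv-oneS n) (mulS-zeroʳ g n)) ⟩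
    deriv g n + 0ℚ                                     ≡⟨ +-identityʳ (deriv g n) ⟩
    deriv g n                                          ≡⟨ trans (*-identityˡ _) (mulS-identityˡ (deriv g) n) ⟨
    1ℚ * mulS oneS (deriv g) n                         ∎
    where open ≡-Reasoning
  deriv-powS g (suc j) n = begin
    deriv (mulS g (powS g (suc j))) n
      ≡⟨ deriv-mulS g (powS g (suc j)) n ⟩
    mulS (deriv g) (powS g (suc j)) n + mulS g (deriv (powS g (suc j))) n
      ≡⟨ cong (mulS (deriv g) (powS g (suc j)) n +_) (mulS-congʳ g (deriv-powS g j) n) ⟩
    mulS (deriv g) (powS g (suc j)) n + mulS g (scaleS (ℕtoℚ (suc j)) (mulS (powS g j) (deriv g))) n
      ≡⟨ cong₂ _+_ (mulS-comm (deriv g) (powS g (suc j)) n)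
                   (trans (mulS-scaleʳ (ℕtoℚ (suc j)) g (mulS (powS g j) (deriv g)) n) (cong (ℕtoℚ (suc j) *_) (sym (mulS-assoc g (powS g j) (deriv g) n)))) ⟩
    x + ℕtoℚ (suc j) * x
      ≡⟨ solve 2 (λ x c → x :+ c :* x := (con 1ℚ :+ c) :* x) refl x (ℕtoℚ (suc j)) ⟩
    (1ℚ + ℕtoℚ (suc j)) * x
      ≡⟨ cong (_* x) (ℕtoℚ-suc (suc j)) ⟨
    ℕtoℚ (suc (suc j)) * x ∎
    where
    open ≡-Reasoning
    x : ℚ
    x = mulS (powS g (suc j)) (deriv g) n

  deriv-injective : ∀ {f g} → deriv f ≗ deriv g → f 0 ≡ g 0 → f ≗ g
  deriv-injective e e₀ zero    = e₀
  deriv-injective e e₀ (suc n) = ℕtoℚ-suc-cancelˡ n (e n)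

  linear-ode-unique : ∀ a y z → deriv y ≗ mulS a y → deriv z ≗ mulS a z → y 0 ≡ z 0 → y ≗ z
  linear-ode-unique a y z ey ez e₀ = <-rec (λ m → y m ≡ z m) step
    where
    step : ∀ m → (∀ {i} → i < m → y i ≡ z i) → y m ≡ z m
    step zero    _     = e₀
    step (suc m) below = ℕtoℚ-suc-cancelˡ m
      (trans (ey m) (trans (mulS-cong-≤ a a y z m (λ _ _ → refl) (λ i i≤m → below (s≤s i≤m))) (sym (ez m))))

module LogExp where

  open import Defs
  open import Data.Nat as ℕ using (ℕ; zero; suc; _≤_; _<_; s≤s; NonZero)
  import Data.Nat.Properties as ℕ
  open import Data.Rational using (ℚ; 0ℚ; 1ℚ; _+_; _*_; -_; _-_)
  open import Data.Rational.Properties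
    using (+-identityˡ; +-identityʳ; +-inverseʳ; *-zeroˡ; *-zeroʳ; *-identityʳ; *-assoc; *-comm)
  open import Data.Rational.Solver using (module +-*-Solver)
  open import Relation.Binary.PropositionalEquality
  open RationalArithmetic
  open FiniteSums
  open PowerSeriesRing
  open Substitution
  open Derivation

  open +-*-Solver

  powS-0-≡1 : ∀ f k → f 0 ≡ 1ℚ → powS f k 0 ≡ 1ℚ
  powS-0-≡1 f k f0≡1 = trans (powS-0 f k) (trans (cong (λ t → powQ t k) f0≡1) (powQ-1ℚ k))

  geometric-sum : ∀ h N → mulS (subS oneS h) (sumS N (powS h)) ≗ subS oneS (powS h N)
  geometric-sum h zero    n = trans (mulS-zeroʳ (subS oneS h) n) (sym (+-inverseʳ (oneS n)))
  geometric-sum h (suc N) n = begin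
    mulS (subS oneS h) (addS (sumS N (powS h)) (powS h N)) n
      ≡⟨ mulS-distribˡ (subS oneS h) (sumS N (powS h)) (powS h N) n ⟩
    mulS (subS oneS h) (sumS N (powS h)) n + mulS (subS oneS h) (powS h N) n
      ≡⟨ cong₂ _+_ (geometric-sum h N n)
                   (trans (mulS-subˡ oneS h (powS h N) n) (cong (_- mulS h (powS h N) n) (mulS-identityˡ (powS h N) n))) ⟩
    (oneS n - powS h N n) + (powS h N n - mulS h (powS h N) n)
      ≡⟨ solve 3 (λ a b c → (a :- b) :+ (b :- c) := a :- c) refl (oneS n) (powS h N n) (mulS h (powS h N) n) ⟩
    oneS n - mulS h (powS h N) n ∎
    where open ≡-Reasoning

  logCoeff : ℕ → ℚ
  logCoeff j = powQ (- 1ℚ) j * invSuc j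

  logPartial : PS → ℕ → PS
  logPartial f N = sumS N (λ j → scaleS (logCoeff j) (powS (subS f oneS) (suc j)))

  subS-oneS-0 : ∀ f → f 0 ≡ 1ℚ → subS f oneS 0 ≡ 0ℚ
  subS-oneS-0 f f0≡1 = cong (_- 1ℚ) f0≡1

  logS-partial : ∀ f n N → f 0 ≡ 1ℚ → n ≤ N → logS f n ≡ logPartial f N n
  logS-partial f n N f0≡1 n≤N = sumQ-extend n N _ n≤N (λ j n≤j _ →
    trans (cong (logCoeff j *_) (powS-vanish (subS f oneS) (suc j) n (subS-oneS-0 f f0≡1) (s≤s n≤j))) (*-zeroʳ (logCoeff j)))

  deriv-logPartial : ∀ f N → deriv (logPartial f N) ≗ mulS (sumS N (powS (subS oneS f))) (deriv f)
  deriv-logPartial f N n = begin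
    deriv (logPartial f N) n
      ≡⟨ deriv-sumS N (λ j → scaleS (logCoeff j) (powS g (suc j))) n ⟩
    sumQ N (λ j → deriv (scaleS (logCoeff j) (powS g (suc j))) n)
      ≡⟨ sumQ-cong N term ⟩
    sumQ N (λ j → mulS (deriv f) (powS h j) n)
      ≡⟨ mulS-sumS (deriv f) N (powS h) n ⟨
    mulS (deriv f) (sumS N (powS h)) n
      ≡⟨ mulS-comm (deriv f) (sumS N (powS h)) n ⟩
    mulS (sumS N (powS h)) (deriv f) n ∎
    where
    open ≡-Reasoning
    g h : PS
    g = subS f oneS
    h = subS oneS f
    h≗-g : h ≗ scaleS (- 1ℚ) g
    h≗-g m = solve 2 (λ x o → o :- x := con (- 1ℚ) :* (x :- o)) refl (f m) (oneS m)
    deriv-g : deriv g ≗ deriv f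
    deriv-g m = trans (deriv-subS f oneS m) (trans (cong (λ t → deriv f m - t) (deriv-oneS m)) (+-identityʳ (deriv f m)))
    term : ∀ j → deriv (scaleS (logCoeff j) (powS g (suc j))) n ≡ mulS (deriv f) (powS h j) n
    term j = begin
      deriv (scaleS (logCoeff j) (powS g (suc j))) n
        ≡⟨ deriv-scaleS (logCoeff j) (powS g (suc j)) n ⟩
      logCoeff j * deriv (powS g (suc j)) n
        ≡⟨ cong (logCoeff j *_) (deriv-powS g j n) ⟩
      logCoeff j * (ℕtoℚ (suc j) * mulS (powS g j) (deriv g) n)
        ≡⟨ solve 4 (λ s i k x → (s :* i) :* (k :* x) := s :* (k :* i) :* x) refl
             (powQ (- 1ℚ) j) (invSuc j) (ℕtoℚ (suc j)) (mulS (powS g j) (deriv g) n) ⟩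
      powQ (- 1ℚ) j * (ℕtoℚ (suc j) * invSuc j) * mulS (powS g j) (deriv g) n
        ≡⟨ cong (λ t → powQ (- 1ℚ) j * t * mulS (powS g j) (deriv g) n) (invSuc-inverse j) ⟩
      powQ (- 1ℚ) j * 1ℚ * mulS (powS g j) (deriv g) n
        ≡⟨ cong (_* mulS (powS g j) (deriv g) n) (*-identityʳ (powQ (- 1ℚ) j)) ⟩
      powQ (- 1ℚ) j * mulS (powS g j) (deriv g) n
        ≡⟨ mulS-scaleˡ (powQ (- 1ℚ) j) (powS g j) (deriv g) n ⟨
      mulS (scaleS (powQ (- 1ℚ) j) (powS g j)) (deriv g) n
        ≡⟨ mulS-cong (≗-sym (≗-trans (powS-cong j h≗-g) (powS-scaleS (- 1ℚ) g j))) deriv-g n ⟩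
      mulS (powS h j) (deriv f) n
        ≡⟨ mulS-comm (powS h j) (deriv f) n ⟩
      mulS (deriv f) (powS h j) n ∎

  -- Truncating log f at N terms, f · Σ_{j<N} (1-f)^j = 1 - (1-f)^N ≡ 1 below q^N.
  logS-deriv : ∀ f → f 0 ≡ 1ℚ → mulS f (deriv (logS f)) ≗ deriv f
  logS-deriv f f0≡1 n = begin
    mulS f (deriv (logS f)) n
      ≡⟨ mulS-cong-≤ f f (deriv (logS f)) (deriv (logPartial f N)) n (λ _ _ → refl)
           (λ i i≤n → cong (ℕtoℚ (suc i) *_) (logS-partial f (suc i) N f0≡1 (s≤s i≤n))) ⟩
    mulS f (deriv (logPartial f N)) n
      ≡⟨ mulS-congʳ f (deriv-logPartial f N) n ⟩
    mulS f (mulS S (deriv f)) n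
      ≡⟨ mulS-assoc f S (deriv f) n ⟨
    mulS (mulS f S) (deriv f) n
      ≡⟨ mulS-congˡ (deriv f) (≗-trans (mulS-congˡ S f≗1-h) (geometric-sum h N)) n ⟩
    mulS (subS oneS (powS h N)) (deriv f) n
      ≡⟨ mulS-subˡ oneS (powS h N) (deriv f) n ⟩
    mulS oneS (deriv f) n - mulS (powS h N) (deriv f) n
      ≡⟨ cong₂ _-_ (mulS-identityˡ (deriv f) n)
                   (mulS-vanish (powS h N) (deriv f) n (λ i i≤n → powS-vanish h N i h₀ (s≤s i≤n))) ⟩
    deriv f n - 0ℚ
      ≡⟨ +-identityʳ (deriv f n) ⟩
    deriv f n ∎
    where
    open ≡-Reasoning
    N : ℕ
    N = suc n
    h S : PS
    h = subS oneS f
    S = sumS N (powS h)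
    f≗1-h : f ≗ subS oneS h
    f≗1-h m = solve 2 (λ x o → x := o :- (o :- x)) refl (f m) (oneS m)
    h₀ : h 0 ≡ 0ℚ
    h₀ = cong (λ t → 1ℚ - t) f0≡1

  logarithmic-derivative-unique : ∀ F L M → F 0 ≡ 1ℚ → mulS F (deriv L) ≗ mulS F (deriv M) → L 0 ≡ M 0 → L ≗ M
  logarithmic-derivative-unique F L M F0≡1 e e₀ = deriv-injective (mulS-cancelˡ F F0≡1 e) e₀

  logS-cong : ∀ {f g} → f ≗ g → logS f ≗ logS g
  logS-cong e n = sumQ-cong n (λ j → cong (logCoeff j *_) (powS-cong (suc j) (λ m → cong (_- oneS m) (e m)) n))

  logS-oneS : logS oneS ≗ zeroS
  logS-oneS n = sumQ-vanish n _ (λ j _ → trans (cong (logCoeff j *_)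
    (mulS-vanish (subS oneS oneS) (powS (subS oneS oneS) j) n (λ i _ → +-inverseʳ (oneS i)))) (*-zeroʳ (logCoeff j)))

  logS-mulS : ∀ f g → f 0 ≡ 1ℚ → g 0 ≡ 1ℚ → logS (mulS f g) ≗ addS (logS f) (logS g)
  logS-mulS f g f0≡1 g0≡1 = logarithmic-derivative-unique F (logS F) (addS (logS f) (logS g)) F0≡1
    (≗-trans (logS-deriv F F0≡1) (≗-sym sum-side)) refl
    where
    F : PS
    F = mulS f g
    F0≡1 : F 0 ≡ 1ℚ
    F0≡1 = trans (mulS-0 f g) (cong₂ _*_ f0≡1 g0≡1)
    sum-side : mulS F (deriv (addS (logS f) (logS g))) ≗ deriv F
    sum-side = ≗-trans (mulS-congʳ F (deriv-addS (logS f) (logS g)))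
      (≗-trans (mulS-distribˡ F (deriv (logS f)) (deriv (logS g)))
      (≗-trans (λ n → cong₂ _+_ (f-part n) (g-part n)) (≗-sym (deriv-mulS f g))))
      where
      f-part : mulS F (deriv (logS f)) ≗ mulS (deriv f) g
      f-part = ≗-trans (mulS-congˡ (deriv (logS f)) (mulS-comm f g)) (≗-trans (mulS-assoc g f (deriv (logS f)))
        (≗-trans (mulS-congʳ g (logS-deriv f f0≡1)) (mulS-comm g (deriv f))))
      g-part : mulS F (deriv (logS g)) ≗ mulS f (deriv g)
      g-part = ≗-trans (mulS-assoc f g (deriv (logS g))) (mulS-congʳ f (logS-deriv g g0≡1))

  logS-powS : ∀ f k → f 0 ≡ 1ℚ → logS (powS f k) ≗ scaleS (ℕtoℚ k) (logS f)
  logS-powS f zero    f0≡1 n = trans (logS-oneS n) (sym (*-zeroˡ (logS f n)))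
  logS-powS f (suc k) f0≡1 n = begin
    logS (mulS f (powS f k)) n                ≡⟨ logS-mulS f (powS f k) f0≡1 (powS-0-≡1 f k f0≡1) n ⟩
    logS f n + logS (powS f k) n              ≡⟨ cong (logS f n +_) (logS-powS f k f0≡1 n) ⟩
    logS f n + ℕtoℚ k * logS f n              ≡⟨ solve 2 (λ x c → x :+ c :* x := (con 1ℚ :+ c) :* x) refl (logS f n) (ℕtoℚ k) ⟩
    (1ℚ + ℕtoℚ k) * logS f n                  ≡⟨ cong (_* logS f n) (ℕtoℚ-suc k) ⟨
    ℕtoℚ (suc k) * logS f n                   ∎
    where open ≡-Reasoning

  logS-invS : ∀ f → f 0 ≡ 1ℚ → logS (invS f) ≗ scaleS (- 1ℚ) (logS f)
  logS-invS f f0≡1 n = begin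
    logS (invS f) n                                       ≡⟨ solve 2 (λ a b → b := (a :+ b) :+ con (- 1ℚ) :* a) refl (logS f n) (logS (invS f) n) ⟩
    (logS f n + logS (invS f) n) + - 1ℚ * logS f n        ≡⟨ cong (_+ - 1ℚ * logS f n) sum≡0 ⟩
    0ℚ + - 1ℚ * logS f n                                  ≡⟨ +-identityˡ _ ⟩
    - 1ℚ * logS f n                                       ∎
    where
    open ≡-Reasoning
    sum≡0 : logS f n + logS (invS f) n ≡ 0ℚ
    sum≡0 = trans (sym (logS-mulS f (invS f) f0≡1 refl n)) (trans (logS-cong (invS-inverseʳ f f0≡1) n) (logS-oneS n))

  module _ (d : ℕ) .{{_ : NonZero d}} where

    logS-substPow : ∀ f → f 0 ≡ 1ℚ → logS (substPow d f) ≗ substPow d (logS f)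
    logS-substPow f f0≡1 n = sym (begin
      sumQ (suc n) (λ i → δ (d ℕ.* i) n (logS f i))
        ≡⟨ sumQ-cong-< (suc n) (λ i i<1+n → trans (cong (δ (d ℕ.* i) n) (logS-partial f i n f0≡1 (ℕ.≤-pred i<1+n)))
                                                 (δ-sumQ (d ℕ.* i) n n _)) ⟩
      sumQ (suc n) (λ i → sumQ n (λ j → δ (d ℕ.* i) n (logCoeff j * powS (subS f oneS) (suc j) i)))
        ≡⟨ sumQ-swap (suc n) n _ ⟩
      sumQ n (λ j → sumQ (suc n) (λ i → δ (d ℕ.* i) n (logCoeff j * powS (subS f oneS) (suc j) i)))
        ≡⟨ sumQ-cong n (λ j → trans (sumQ-cong (suc n) (λ i → sym (δ-*ˡ (d ℕ.* i) n (logCoeff j) _)))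
                                    (sym (sumQ-*ˡ (suc n) (logCoeff j) _))) ⟩
      sumQ n (λ j → logCoeff j * substPow d (powS (subS f oneS) (suc j)) n)
        ≡⟨ sumQ-cong n (λ j → cong (logCoeff j *_) (trans (substPow-powS d (subS f oneS) (suc j) n)
                                                          (powS-cong (suc j) (≗-sym substitute-subS-oneS) n))) ⟩
      logS (substPow d f) n ∎)
      where
      open ≡-Reasoning
      substitute-subS-oneS : subS (substPow d f) oneS ≗ substPow d (subS f oneS)
      substitute-subS-oneS m = trans (cong (λ t → substPow d f m - t) (sym (substPow-oneS d m))) (sym (substPow-subS d f oneS m))

  expS : PS → PS
  expS L n = sumQ (suc n) (λ k → invFact k * powS L k n)

  expS-partial : ∀ L m N → L 0 ≡ 0ℚ → m < N → expS L m ≡ sumQ N (λ k → invFact k * powS L k m)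
  expS-partial L m N L0≡0 m<N = sumQ-extend (suc m) N _ m<N (λ k m<k _ →
    trans (cong (invFact k *_) (powS-vanish L k m L0≡0 m<k)) (*-zeroʳ (invFact k)))

  expS-cong : ∀ {L M} → L ≗ M → expS L ≗ expS M
  expS-cong e n = sumQ-cong (suc n) (λ k → cong (invFact k *_) (powS-cong k e n))

  deriv-expS : ∀ L → L 0 ≡ 0ℚ → deriv (expS L) ≗ mulS (deriv L) (expS L)
  deriv-expS L L0≡0 n = begin
    ℕtoℚ (suc n) * sumQ (suc (suc n)) (λ k → invFact k * powS L k (suc n))
      ≡⟨ trans (sumQ-*ˡ (suc (suc n)) (ℕtoℚ (suc n)) _)
               (sumQ-cong (suc (suc n)) (λ k → solve 3 (λ a b c → a :* (b :* c) := b :* (a :* c)) refl (ℕtoℚ (suc n)) (invFact k) _)) ⟩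
    sumQ (suc (suc n)) (λ k → invFact k * deriv (powS L k) n)
      ≡⟨ sumQ-head (suc n) _ ⟩
    invFact 0 * deriv oneS n + sumQ (suc n) (λ k → invFact (suc k) * deriv (powS L (suc k)) n)
      ≡⟨ cong₂ _+_ (trans (cong (invFact 0 *_) (deriv-oneS n)) (*-zeroʳ (invFact 0))) (sumQ-cong (suc n) term) ⟩
    0ℚ + sumQ (suc n) (λ k → mulS (deriv L) (scaleS (invFact k) (powS L k)) n)
      ≡⟨ trans (+-identityˡ _) (sym (mulS-sumS (deriv L) (suc n) (λ k → scaleS (invFact k) (powS L k)) n)) ⟩
    mulS (deriv L) (sumS (suc n) (λ k → scaleS (invFact k) (powS L k))) n
      ≡⟨ mulS-cong-≤ (deriv L) (deriv L) _ (expS L) n (λ _ _ → refl) (λ i i≤n → sym (expS-partial L i (suc n) L0≡0 (s≤s i≤n))) ⟩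
    mulS (deriv L) (expS L) n ∎
    where
    open ≡-Reasoning
    term : ∀ k → invFact (suc k) * deriv (powS L (suc k)) n ≡ mulS (deriv L) (scaleS (invFact k) (powS L k)) n
    term k = begin
      invFact (suc k) * deriv (powS L (suc k)) n
        ≡⟨ cong (invFact (suc k) *_) (deriv-powS L k n) ⟩
      invFact (suc k) * (ℕtoℚ (suc k) * mulS (powS L k) (deriv L) n)
        ≡⟨ sym (*-assoc (invFact (suc k)) (ℕtoℚ (suc k)) _) ⟩
      invFact (suc k) * ℕtoℚ (suc k) * mulS (powS L k) (deriv L) n
        ≡⟨ cong (_* mulS (powS L k) (deriv L) n) (trans (*-comm (invFact (suc k)) (ℕtoℚ (suc k))) (ℕtoℚ-suc*invFact-suc k)) ⟩
      invFact k * mulS (powS L k) (deriv L) n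
        ≡⟨ mulS-scaleˡ (invFact k) (powS L k) (deriv L) n ⟨
      mulS (scaleS (invFact k) (powS L k)) (deriv L) n
        ≡⟨ mulS-comm (scaleS (invFact k) (powS L k)) (deriv L) n ⟩
      mulS (deriv L) (scaleS (invFact k) (powS L k)) n ∎

  expS-logS : ∀ f → f 0 ≡ 1ℚ → expS (logS f) ≗ f
  expS-logS f f0≡1 = linear-ode-unique (deriv (logS f)) (expS (logS f)) f (deriv-expS (logS f) refl)
    (≗-trans (≗-sym (logS-deriv f f0≡1)) (mulS-comm f (deriv (logS f)))) (sym f0≡1)

  expS-addS : ∀ L M → L 0 ≡ 0ℚ → M 0 ≡ 0ℚ → expS (addS L M) ≗ mulS (expS L) (expS M)
  expS-addS L M L0≡0 M0≡0 = linear-ode-unique (deriv (addS L M)) (expS (addS L M)) (mulS (expS L) (expS M))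
    (deriv-expS (addS L M) (cong₂ _+_ L0≡0 M0≡0)) product-ode refl
    where
    product-ode : deriv (mulS (expS L) (expS M)) ≗ mulS (deriv (addS L M)) (mulS (expS L) (expS M))
    product-ode = ≗-trans (deriv-mulS (expS L) (expS M))
      (≗-trans (λ n → cong₂ _+_ (trans (mulS-congˡ (expS M) (deriv-expS L L0≡0) n) (mulS-assoc (deriv L) (expS L) (expS M) n))
                                (trans (mulS-congʳ (expS L) (deriv-expS M M0≡0) n) (mulS-swapˡ (expS L) (deriv M) (expS M) n)))
      (≗-trans (≗-sym (mulS-distribʳ (deriv L) (deriv M) E)) (mulS-congˡ E (≗-sym (deriv-addS L M)))))
      where E = mulS (expS L) (expS M)

module SeriesInX where

  open import Defs
  open import Data.Nat as ℕ using (ℕ; zero; suc; _<_; _∸_; s≤s)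
  import Data.Nat.Properties as ℕ
  open import Data.Rational using (ℚ; 0ℚ; _+_; _*_)
  open import Data.Rational.Properties using (+-identityˡ; +-identityʳ; *-identityˡ; *-zeroʳ; *-assoc)
  open import Relation.Nullary using (yes; no)
  open import Data.Rational.Solver using (module +-*-Solver)
  open import Relation.Binary.PropositionalEquality
  open RationalArithmetic
  open FiniteSums
  open PowerSeriesRing
  open Derivation

  open +-*-Solver

  dividedPower : ℕ → PS → PS
  dividedPower j L = scaleS (invFact j) (powS L j)

  dividedPower-suc : ∀ j L → scaleS (ℕtoℚ (suc j)) (dividedPower (suc j) L) ≗ mulS L (dividedPower j L)
  dividedPower-suc j L n = trans (sym (*-assoc (ℕtoℚ (suc j)) (invFact (suc j)) _))
    (trans (cong (_* powS L (suc j) n) (ℕtoℚ-suc*invFact-suc j)) (sym (mulS-scaleʳ (invFact j) L (powS L j) n)))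

  mulS-δ : ∀ f a b X n → mulS f (λ m → δ a b (X m)) n ≡ δ a b (mulS f X n)
  mulS-δ f a b X n with a ℕ.≟ b
  ... | yes refl = trans (mulS-congʳ f (λ m → δ-refl a (X m)) n) (sym (δ-refl a _))
  ... | no a≢b   = trans (sumQ-vanish (suc n) _ (λ i _ → trans (cong (f i *_) (δ-≢ _ a≢b)) (*-zeroʳ (f i))))
                         (sym (δ-≢ _ a≢b))

  powB-linX : ∀ L k j → powB (linX L) k j ≗ (λ n → δ k j (powS L k n))
  powB-linX L zero    zero    n = sym (δ-refl 0 (oneS n))
  powB-linX L zero    (suc j) n = sym (δ-≢ {0} {suc j} (oneS n) (λ ()))
  powB-linX L (suc k) zero    n = trans (+-identityˡ _) (trans (mulS-zeroˡ (powB (linX L) k 0) n) (sym (δ-≢ {suc k} {0} (powS L (suc k) n) (λ ()))))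
  powB-linX L (suc k) (suc j) n = begin
    sumQ (suc (suc j)) Y
      ≡⟨ sumQ-head (suc j) Y ⟩
    Y 0 + sumQ (suc j) (λ i → Y (suc i))
      ≡⟨ cong (Y 0 +_) (sumQ-head j (λ i → Y (suc i))) ⟩
    Y 0 + (Y 1 + sumQ j (λ i → Y (suc (suc i))))
      ≡⟨ cong₂ (λ s t → s + (Y 1 + t)) (mulS-zeroˡ (powB (linX L) k (suc j)) n)
                                        (sumQ-vanish j _ (λ i _ → mulS-zeroˡ (powB (linX L) k (j ∸ suc i)) n)) ⟩
    0ℚ + (Y 1 + 0ℚ)
      ≡⟨ trans (+-identityˡ _) (+-identityʳ (Y 1)) ⟩
    mulS L (powB (linX L) k j) n
      ≡⟨ mulS-congʳ L (powB-linX L k j) n ⟩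
    mulS L (λ m → δ k j (powS L k m)) n
      ≡⟨ mulS-δ L k j (powS L k) n ⟩
    δ k j (powS L (suc k) n)
      ≡⟨ δ-⇔ k j (suc k) (suc j) _ (cong suc) ℕ.suc-injective ⟩
    δ (suc k) (suc j) (powS L (suc k) n) ∎
    where
    open ≡-Reasoning
    Y : ℕ → ℚ
    Y i = mulS (linX L i) (powB (linX L) k (suc j ∸ i)) n

  expB-linX : ∀ L j → expB (linX L) j ≗ dividedPower j L
  expB-linX L j n = trans (sumQ-cong (suc j) (λ k → trans (cong (invFact k *_) (powB-linX L k j n)) (δ-*ˡ k j (invFact k) _)))
    (sumQ-δ (suc j) j (λ k → invFact k * powS L k n) (ℕ.n<1+n j))

  binomialSum : PS → PS → ℕ → PS
  binomialSum a b j = sumS (suc j) (λ i → mulS (dividedPower i a) (dividedPower (j ∸ i) b))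

  -- (j+1)·Σ = a·Σ + b·Σ: the weight split of the derivative, with (i+1)/(i+1)! = 1/i!.
  binomialSum-suc : ∀ a b j → scaleS (ℕtoℚ (suc j)) (binomialSum a b (suc j)) ≗ mulS (addS a b) (binomialSum a b j)
  binomialSum-suc a b j n = begin
    ℕtoℚ (suc j) * binomialSum a b (suc j) n
      ≡⟨ antidiagonal-weight-split j β ⟩
    sumQ (suc j) (λ i → ℕtoℚ (suc i) * β (suc i) (j ∸ i)) + sumQ (suc j) (λ i → ℕtoℚ (suc j ∸ i) * β i (suc j ∸ i))
      ≡⟨ cong₂ _+_ (sumQ-cong (suc j) a-term) (sumQ-cong-< (suc j) b-term) ⟩
    sumQ (suc j) (λ i → mulS a (γ i) n) + sumQ (suc j) (λ i → mulS b (γ i) n)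
      ≡⟨ cong₂ _+_ (mulS-sumS a (suc j) γ n) (mulS-sumS b (suc j) γ n) ⟨
    mulS a (binomialSum a b j) n + mulS b (binomialSum a b j) n
      ≡⟨ mulS-distribʳ a b (binomialSum a b j) n ⟨
    mulS (addS a b) (binomialSum a b j) n ∎
    where
    open ≡-Reasoning
    β : ℕ → ℕ → ℚ
    β i k = mulS (dividedPower i a) (dividedPower k b) n
    γ : ℕ → PS
    γ i = mulS (dividedPower i a) (dividedPower (j ∸ i) b)
    a-term : ∀ i → ℕtoℚ (suc i) * β (suc i) (j ∸ i) ≡ mulS a (γ i) n
    a-term i = trans (sym (mulS-scaleˡ (ℕtoℚ (suc i)) (dividedPower (suc i) a) (dividedPower (j ∸ i) b) n))
      (trans (mulS-congˡ (dividedPower (j ∸ i) b) (dividedPower-suc i a) n) (mulS-assoc a (dividedPower i a) (dividedPower (j ∸ i) b) n))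
    b-term : ∀ i → i < suc j → ℕtoℚ (suc j ∸ i) * β i (suc j ∸ i) ≡ mulS b (γ i) n
    b-term i i<1+j = trans (cong (λ t → ℕtoℚ t * β i t) (ℕ.+-∸-assoc 1 (ℕ.≤-pred i<1+j)))
      (trans (sym (mulS-scaleʳ (ℕtoℚ (suc (j ∸ i))) (dividedPower i a) (dividedPower (suc (j ∸ i)) b) n))
      (trans (mulS-congʳ (dividedPower i a) (dividedPower-suc (j ∸ i) b) n) (mulS-swapˡ (dividedPower i a) b (dividedPower (j ∸ i) b) n)))

  binomialSum-dividedPower : ∀ a b j → binomialSum a b j ≗ dividedPower j (addS a b)
  binomialSum-dividedPower a b zero n = trans (+-identityˡ _)
    (trans (mulS-congˡ (dividedPower 0 b) (λ m → *-identityˡ (oneS m)) n)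
    (trans (mulS-identityˡ (dividedPower 0 b) n) (trans (*-identityˡ (oneS n)) (sym (*-identityˡ (oneS n))))))
  binomialSum-dividedPower a b (suc j) n = ℕtoℚ-suc-cancelˡ j (trans (binomialSum-suc a b j n)
    (trans (mulS-congʳ (addS a b) (binomialSum-dividedPower a b j) n) (sym (dividedPower-suc j (addS a b) n))))

  expB-linX-addS : ∀ a b j → mulB (expB (linX a)) (expB (linX b)) j ≗ expB (linX (addS a b)) j
  expB-linX-addS a b j n = begin
    sumQ (suc j) (λ i → mulS (expB (linX a) i) (expB (linX b) (j ∸ i)) n)
      ≡⟨ sumQ-cong (suc j) (λ i → mulS-cong (expB-linX a i) (expB-linX b (j ∸ i)) n) ⟩
    binomialSum a b j n
      ≡⟨ binomialSum-dividedPower a b j n ⟩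
    dividedPower j (addS a b) n
      ≡⟨ expB-linX (addS a b) j n ⟨
    expB (linX (addS a b)) j n ∎
    where open ≡-Reasoning

  expB-linX-cong : ∀ {L M} j → L ≗ M → expB (linX L) j ≗ expB (linX M) j
  expB-linX-cong {L} {M} j L≗M n =
    trans (expB-linX L j n) (trans (cong (invFact j *_) (powS-cong j L≗M n)) (sym (expB-linX M j n)))

  expB-linX-scaleS : ∀ c V j → expB (linX (scaleS c V)) j ≗ scaleS (powQ c j * invFact j) (powS V j)
  expB-linX-scaleS c V j n = trans (expB-linX (scaleS c V) j n) (trans (cong (invFact j *_) (powS-scaleS c V j n))
    (solve 3 (λ a b x → a :* (b :* x) := b :* a :* x) refl (invFact j) (powQ c j) (powS V j n)))

  truncExp3-< : ∀ c V j → j < 4 → truncExp3 c V j ≗ scaleS (powQ c j * invFact j) (powS V j)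
  truncExp3-< c V 0 _ n = refl
  truncExp3-< c V 1 _ n = refl
  truncExp3-< c V 2 _ n = refl
  truncExp3-< c V 3 _ n = refl
  truncExp3-< c V (suc (suc (suc (suc j)))) (s≤s (s≤s (s≤s (s≤s ()))))

  expB-linX≗truncExp3 : ∀ c V j → j < 4 → expB (linX (scaleS c V)) j ≗ truncExp3 c V j
  expB-linX≗truncExp3 c V j j<4 = ≗-trans (expB-linX-scaleS c V j) (≗-sym (truncExp3-< c V j j<4))

module Valuation where

  open import Defs using (vp)
  open import Data.Bool using (Bool; true; false; if_then_else_)
  open import Data.Nat as ℕ using (ℕ; zero; suc; _≤_; _<_; _^_; z≤n; s≤s)
  import Data.Nat.Properties as ℕ
  open import Data.Nat.Divisibility as ℕ using (_∣_; _∣?_)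
  open import Data.Empty using (⊥-elim)
  open import Data.Sum using (_⊎_; inj₁; inj₂)
  open import Relation.Nullary using (¬_; Dec; does; yes; no)
  open import Relation.Binary.PropositionalEquality

  true⇒ : ∀ {A : Set} (a? : Dec A) → does a? ≡ true → A
  true⇒ (yes a) _ = a

  false⇒ : ∀ {A : Set} (a? : Dec A) → does a? ≡ false → ¬ A
  false⇒ (no ¬a) _ = ¬a

  n<m^n : ∀ m → 1 < m → ∀ n → n < m ^ n
  n<m^n m 1<m zero    = s≤s z≤n
  n<m^n m 1<m (suc n) = ℕ.≤-<-trans (n<m^n m 1<m n) (ℕ.^-monoʳ-< m 1<m (ℕ.n<1+n n))

  record LargestUpTo (P : ℕ → Bool) (b r : ℕ) : Set where
    field
      bounded : r ≤ b
      holds   : P r ≡ true ⊎ r ≡ 0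
      largest : ∀ e → r < e → e ≤ b → P e ≡ false

  largest-search : (P : ℕ → Bool) (F : ℕ → ℕ) → F 0 ≡ 0 → (∀ b → F (suc b) ≡ (if P (suc b) then suc b else F b)) →
                   ∀ b → LargestUpTo P b (F b)
  largest-search P F F0 Fsuc zero rewrite F0 = record
    { bounded = z≤n ; holds = inj₂ refl ; largest = λ e 0<e e≤0 → ⊥-elim (ℕ.<-irrefl refl (ℕ.<-≤-trans 0<e e≤0)) }
  largest-search P F F0 Fsuc (suc b) with P (suc b) in P[1+b] | Fsuc b | largest-search P F F0 Fsuc b
  ... | true  | F[1+b] | _ rewrite F[1+b] = record
    { bounded = ℕ.≤-refl
    ; holds   = inj₁ P[1+b]
    ; largest = λ e 1+b<e e≤1+b → ⊥-elim (ℕ.<-irrefl refl (ℕ.<-≤-trans 1+b<e e≤1+b)) }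
  ... | false | F[1+b] | below rewrite F[1+b] = record
    { bounded = ℕ.m≤n⇒m≤1+n (LargestUpTo.bounded below)
    ; holds   = LargestUpTo.holds below
    ; largest = beyond }
    where
    beyond : ∀ e → F b < e → e ≤ suc b → P e ≡ false
    beyond e Fb<e e≤1+b with ℕ.m≤n⇒m<n∨m≡n e≤1+b
    ... | inj₁ e<1+b = LargestUpTo.largest below e Fb<e (ℕ.≤-pred e<1+b)
    ... | inj₂ refl  = P[1+b]

  -- The search behind vp is private; abstracting vp's predicate and bound turns it into a
  -- pattern, so unification can solve for it.
  mutual
    search : (ℕ → Bool) → ℕ → ℕ
    search = _

    vp≡search : ∀ q n → vp q n ≡ search (λ e → does (q ^ e ∣? n)) n
    vp≡search q n with (λ e → does (q ^ e ∣? n))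
    ... | P with n
    ... | m = refl

  vp-largest : ∀ q n → LargestUpTo (λ e → does (q ^ e ∣? n)) n (vp q n)
  vp-largest q n = subst (LargestUpTo _ n) (sym (vp≡search q n)) (largest-search _ (search _) refl (λ _ → refl) n)

  vp-∣ : ∀ q n → q ^ vp q n ∣ n
  vp-∣ q n with LargestUpTo.holds (vp-largest q n)
  ... | inj₁ holds = true⇒ (q ^ vp q n ∣? n) holds
  ... | inj₂ vp≡0  = subst (λ v → q ^ v ∣ n) (sym vp≡0) (ℕ.1∣ n)

  vp-maximal : ∀ q n → 1 < q → 0 < n → ¬ q ^ suc (vp q n) ∣ n
  vp-maximal q n 1<q 0<n q^[1+v]∣n =
    false⇒ (q ^ suc (vp q n) ∣? n) (LargestUpTo.largest (vp-largest q n) (suc (vp q n)) ℕ.≤-refl 1+v≤n) q^[1+v]∣n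
    where
    1+v≤n : suc (vp q n) ≤ n
    1+v≤n = ℕ.<⇒≤ (ℕ.<-≤-trans (n<m^n q 1<q (suc (vp q n))) (ℕ.∣⇒≤ {{ℕ.>-nonZero 0<n}} q^[1+v]∣n))

module PrimeDivisibility (p : ℕ) (p-prime : Prime p) where

  open import Data.Nat as ℕ using (zero; suc; _<_; _∸_; _^_; _!)
  import Data.Nat.Properties as ℕ
  open import Data.Nat.Divisibility as ℕ using (_∣_; divides)
  open import Data.Nat.Primality using (euclidsLemma; prime⇒nonZero; prime⇒nonTrivial)
  open import Data.Empty using (⊥-elim)
  open import Data.Product using (Σ; _×_; _,_)
  open import Data.Sum using (inj₁; inj₂)
  open import Relation.Nullary using (¬_)
  open import Relation.Binary.PropositionalEquality
  open import Defs using (vp)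
  open Valuation

  instance
    p≢0 : ℕ.NonZero p
    p≢0 = prime⇒nonZero p-prime

  1<p : 1 < p
  1<p = ℕ.nonTrivial⇒n>1 p {{prime⇒nonTrivial p-prime}}

  p∤1 : ¬ p ∣ 1
  p∤1 p∣1 = ℕ.<-irrefl (sym (ℕ.∣1⇒≡1 p∣1)) 1<p

  p∤-* : ∀ {a b} → ¬ p ∣ a → ¬ p ∣ b → ¬ p ∣ a ℕ.* b
  p∤-* {a} {b} p∤a p∤b p∣ab with euclidsLemma a b p-prime p∣ab
  ... | inj₁ p∣a = p∤a p∣a
  ... | inj₂ p∣b = p∤b p∣b

  p∤k! : ∀ k → k < p → ¬ p ∣ k !
  p∤k! zero    _   = p∤1
  p∤k! (suc k) k<p p∣k! with euclidsLemma (suc k) (k !) p-prime p∣k!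
  ... | inj₁ p∣1+k = ℕ.<-irrefl refl (ℕ.<-≤-trans k<p (ℕ.∣⇒≤ p∣1+k))
  ... | inj₂ p∣k!′ = p∤k! k (ℕ.<-trans (ℕ.n<1+n k) k<p) p∣k!′

  p^e∣m*b⇒p^e∣m : ∀ e m b → ¬ p ∣ b → p ^ e ∣ m ℕ.* b → p ^ e ∣ m
  p^e∣m*b⇒p^e∣m zero    m b _   _ = ℕ.1∣ m
  p^e∣m*b⇒p^e∣m (suc e) m b p∤b d with euclidsLemma m b p-prime (ℕ.∣-trans (ℕ.m∣m*n (p ^ e)) d)
  ... | inj₂ p∣b = ⊥-elim (p∤b p∣b)
  ... | inj₁ (divides q refl) = subst (p ^ suc e ∣_) (ℕ.*-comm p q) (ℕ.*-monoʳ-∣ p (p^e∣m*b⇒p^e∣m e q b p∤b p^e∣q*b))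
    where
    p^e∣q*b : p ^ e ∣ q ℕ.* b
    p^e∣q*b = ℕ.*-cancelˡ-∣ p (subst (p ℕ.* p ^ e ∣_)
      (trans (ℕ.*-assoc q p b) (trans (cong (q ℕ.*_) (ℕ.*-comm p b)) (trans (sym (ℕ.*-assoc q b p)) (ℕ.*-comm (q ℕ.* b) p)))) d)

  p≡1+[p∸1] : p ≡ suc (p ∸ 1)
  p≡1+[p∸1] = sym (ℕ.suc-pred p)

  vp-decomposition : ∀ n → 0 < n → Σ ℕ (λ w → n ≡ p ^ vp p n ℕ.* w × ¬ p ∣ w)
  vp-decomposition n 0<n with vp-∣ p n
  ... | divides w n≡w*p^v = w , trans n≡w*p^v (ℕ.*-comm w _) , p∤w
    where
    p∤w : ¬ p ∣ w
    p∤w (divides c w≡c*p) = vp-maximal p n 1<p 0<n (divides c (trans n≡w*p^v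
      (trans (cong (ℕ._* p ^ vp p n) w≡c*p) (ℕ.*-assoc c p (p ^ vp p n)))))

module PAdic (p : ℕ) (p-prime : Prime p) where

  open import Defs
  open import Data.Nat as ℕ using (zero; suc; _≤_; _<_; _∸_; _^_; s≤s)
  import Data.Nat.Properties as ℕ
  open import Data.Nat.Induction using (<-rec)
  open import Data.Nat.Divisibility as ℕ using (_∣_; divides)
  import Data.Nat.Coprimality as Coprime
  open import Data.Integer as ℤ using (ℤ; +_)
  import Data.Integer.Properties as ℤ
  open import Data.Rational as ℚ using (ℚ; 0ℚ; 1ℚ; _+_; _*_; -_; _-_; ↥_; ↧_; ↧ₙ_)
  open import Data.Rational.Properties
    using (+-inverseʳ; *-zeroˡ; *-zeroʳ; *-identityˡ; *-identityʳ; *-assoc; neg-distribˡ-*; neg-distribʳ-*)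
  open import Data.Rational.Solver using (module +-*-Solver)
  open import Data.Product using (_,_)
  open import Relation.Nullary using (¬_; yes; no)
  open import Relation.Binary.PropositionalEquality
  open RationalArithmetic
  open FiniteSums
  open PowerSeriesRing
  open PrimeDivisibility p p-prime

  open +-*-Solver

  -- x ∈ p^e ℤ_(p), with the witness fraction not required to be in lowest terms.
  record p^_∣ₚ_ (e : ℕ) (x : ℚ) : Set where
    constructor witness
    field
      numerator     : ℤ
      denominator   : ℕ
      p∤denominator : ¬ p ∣ denominator
      scaled        : x * ℕtoℚ denominator ≡ ℕtoℚ (p ^ e) * ℤtoℚ numerator

  ∣ₚ-0ℚ : ∀ e → p^ e ∣ₚ 0ℚ
  ∣ₚ-0ℚ e = witness (+ 0) 1 p∤1 (trans (*-zeroˡ 1ℚ) (sym (*-zeroʳ (ℕtoℚ (p ^ e)))))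

  ∣ₚ-ℤtoℚ : ∀ z → p^ 0 ∣ₚ ℤtoℚ z
  ∣ₚ-ℤtoℚ z = witness z 1 p∤1 (trans (*-identityʳ (ℤtoℚ z)) (sym (*-identityˡ (ℤtoℚ z))))

  ∣ₚ-ℕtoℚ : ∀ k → p^ 0 ∣ₚ ℕtoℚ k
  ∣ₚ-ℕtoℚ k = ∣ₚ-ℤtoℚ (+ k)

  ∣ₚ-+ : ∀ {e x y} → p^ e ∣ₚ x → p^ e ∣ₚ y → p^ e ∣ₚ (x + y)
  ∣ₚ-+ {e} {x} {y} (witness a b p∤b ex) (witness a′ b′ p∤b′ ey) =
    witness (a ℤ.* + b′ ℤ.+ a′ ℤ.* + b) (b ℕ.* b′) (p∤-* p∤b p∤b′) (begin
      (x + y) * ℕtoℚ (b ℕ.* b′)                ≡⟨ cong ((x + y) *_) (ℕtoℚ-* b b′) ⟩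
      (x + y) * (B * B′)                       ≡⟨ solve 4 (λ x y B B′ → (x :+ y) :* (B :* B′) := (x :* B) :* B′ :+ (y :* B′) :* B) refl x y B B′ ⟩
      (x * B) * B′ + (y * B′) * B              ≡⟨ cong₂ (λ s t → s * B′ + t * B) ex ey ⟩
      (P * A) * B′ + (P * A′) * B              ≡⟨ solve 5 (λ P A A′ B B′ → (P :* A) :* B′ :+ (P :* A′) :* B := P :* (A :* B′ :+ A′ :* B)) refl P A A′ B B′ ⟩
      P * (A * B′ + A′ * B)                    ≡⟨ cong (P *_) (trans (ℤtoℚ-+ (a ℤ.* + b′) (a′ ℤ.* + b)) (cong₂ _+_ (ℤtoℚ-* a (+ b′)) (ℤtoℚ-* a′ (+ b)))) ⟨
      P * ℤtoℚ (a ℤ.* + b′ ℤ.+ a′ ℤ.* + b)     ∎)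
    where
    open ≡-Reasoning
    B B′ P A A′ : ℚ
    B = ℕtoℚ b
    B′ = ℕtoℚ b′
    P = ℕtoℚ (p ^ e)
    A = ℤtoℚ a
    A′ = ℤtoℚ a′

  ∣ₚ-neg : ∀ {e x} → p^ e ∣ₚ x → p^ e ∣ₚ (- x)
  ∣ₚ-neg {e} {x} (witness a b p∤b ex) = witness (ℤ.- a) b p∤b (begin
    - x * ℕtoℚ b                  ≡⟨ neg-distribˡ-* x (ℕtoℚ b) ⟨
    - (x * ℕtoℚ b)                ≡⟨ cong -_ ex ⟩
    - (ℕtoℚ (p ^ e) * ℤtoℚ a)     ≡⟨ neg-distribʳ-* (ℕtoℚ (p ^ e)) (ℤtoℚ a) ⟩
    ℕtoℚ (p ^ e) * - ℤtoℚ a       ≡⟨ cong (ℕtoℚ (p ^ e) *_) (ℤtoℚ-neg a) ⟨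
    ℕtoℚ (p ^ e) * ℤtoℚ (ℤ.- a)   ∎)
    where open ≡-Reasoning

  ∣ₚ-- : ∀ {e x y} → p^ e ∣ₚ x → p^ e ∣ₚ y → p^ e ∣ₚ (x - y)
  ∣ₚ-- x∣ y∣ = ∣ₚ-+ x∣ (∣ₚ-neg y∣)

  ∣ₚ-* : ∀ {e e′ x y} → p^ e ∣ₚ x → p^ e′ ∣ₚ y → p^ (e ℕ.+ e′) ∣ₚ (x * y)
  ∣ₚ-* {e} {e′} {x} {y} (witness a b p∤b ex) (witness a′ b′ p∤b′ ey) = witness (a ℤ.* a′) (b ℕ.* b′) (p∤-* p∤b p∤b′) (begin
    x * y * ℕtoℚ (b ℕ.* b′)                          ≡⟨ cong (x * y *_) (ℕtoℚ-* b b′) ⟩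
    x * y * (ℕtoℚ b * ℕtoℚ b′)                       ≡⟨ solve 4 (λ x y B B′ → x :* y :* (B :* B′) := (x :* B) :* (y :* B′)) refl x y (ℕtoℚ b) (ℕtoℚ b′) ⟩
    (x * ℕtoℚ b) * (y * ℕtoℚ b′)                     ≡⟨ cong₂ _*_ ex ey ⟩
    (P * ℤtoℚ a) * (P′ * ℤtoℚ a′)                    ≡⟨ solve 4 (λ P A P′ A′ → (P :* A) :* (P′ :* A′) := (P :* P′) :* (A :* A′)) refl P (ℤtoℚ a) P′ (ℤtoℚ a′) ⟩
    (P * P′) * (ℤtoℚ a * ℤtoℚ a′)                    ≡⟨ cong₂ _*_ (trans (sym (ℕtoℚ-* (p ^ e) (p ^ e′))) (cong ℕtoℚ (sym (ℕ.^-distribˡ-+-* p e e′))))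
                                                                  (sym (ℤtoℚ-* a a′)) ⟩
    ℕtoℚ (p ^ (e ℕ.+ e′)) * ℤtoℚ (a ℤ.* a′)          ∎)
    where
    open ≡-Reasoning
    P P′ : ℚ
    P = ℕtoℚ (p ^ e)
    P′ = ℕtoℚ (p ^ e′)

  ∣ₚ-*ʳ : ∀ {e x y} → p^ e ∣ₚ x → p^ 0 ∣ₚ y → p^ e ∣ₚ (x * y)
  ∣ₚ-*ʳ {e} x∣ y∣ = subst (λ k → p^ k ∣ₚ _) (ℕ.+-identityʳ e) (∣ₚ-* x∣ y∣)

  ∣ₚ-powQ : ∀ {x} k → p^ 0 ∣ₚ x → p^ 0 ∣ₚ powQ x k
  ∣ₚ-powQ zero    x∣ = ∣ₚ-ℕtoℚ 1
  ∣ₚ-powQ (suc k) x∣ = ∣ₚ-* x∣ (∣ₚ-powQ k x∣)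

  ∣ₚ-weaken : ∀ {e e′ x} → e′ ≤ e → p^ e ∣ₚ x → p^ e′ ∣ₚ x
  ∣ₚ-weaken {e} {e′} {x} e′≤e (witness a b p∤b ex) = witness (+ (p ^ (e ∸ e′)) ℤ.* a) b p∤b (begin
    x * ℕtoℚ b                                        ≡⟨ ex ⟩
    ℕtoℚ (p ^ e) * ℤtoℚ a                             ≡⟨ cong (λ k → ℕtoℚ (p ^ k) * ℤtoℚ a) (ℕ.m+[n∸m]≡n e′≤e) ⟨
    ℕtoℚ (p ^ (e′ ℕ.+ (e ∸ e′))) * ℤtoℚ a             ≡⟨ cong (λ t → ℕtoℚ t * ℤtoℚ a) (ℕ.^-distribˡ-+-* p e′ (e ∸ e′)) ⟩
    ℕtoℚ (p ^ e′ ℕ.* p ^ (e ∸ e′)) * ℤtoℚ a           ≡⟨ cong (_* ℤtoℚ a) (ℕtoℚ-* (p ^ e′) (p ^ (e ∸ e′))) ⟩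
    ℕtoℚ (p ^ e′) * ℕtoℚ (p ^ (e ∸ e′)) * ℤtoℚ a      ≡⟨ *-assoc (ℕtoℚ (p ^ e′)) _ (ℤtoℚ a) ⟩
    ℕtoℚ (p ^ e′) * (ℕtoℚ (p ^ (e ∸ e′)) * ℤtoℚ a)    ≡⟨ cong (ℕtoℚ (p ^ e′) *_) (ℤtoℚ-* (+ (p ^ (e ∸ e′))) a) ⟨
    ℕtoℚ (p ^ e′) * ℤtoℚ (+ (p ^ (e ∸ e′)) ℤ.* a)     ∎)
    where open ≡-Reasoning

  ∣ₚ-unit : ∀ c w → c * ℕtoℚ w ≡ 1ℚ → ¬ p ∣ w → p^ 0 ∣ₚ c
  ∣ₚ-unit c w cw≡1 p∤w = witness (+ 1) w p∤w cw≡1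

  ∣ₚ-divide : ∀ {e y} c v w → c * ℕtoℚ (p ^ v ℕ.* w) ≡ 1ℚ → ¬ p ∣ w → v ≤ e → p^ e ∣ₚ y → p^ (e ∸ v) ∣ₚ (y * c)
  ∣ₚ-divide {e} {y} c v w c-inverse p∤w v≤e (witness a b p∤b ey) = witness a (b ℕ.* w) (p∤-* p∤b p∤w) (begin
    y * c * ℕtoℚ (b ℕ.* w)             ≡⟨ cong (y * c *_) (ℕtoℚ-* b w) ⟩
    y * c * (B * W)                    ≡⟨ solve 4 (λ y c B W → y :* c :* (B :* W) := (y :* B) :* (c :* W)) refl y c B W ⟩
    (y * B) * (c * W)                  ≡⟨ cong (_* (c * W)) (trans ey (cong (_* A) split-p^e)) ⟩
    (Pr * Pv * A) * (c * W)            ≡⟨ solve 5 (λ Pr Pv A c W → (Pr :* Pv :* A) :* (c :* W) := (Pr :* A) :* (c :* (Pv :* W))) refl Pr Pv A c W ⟩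
    (Pr * A) * (c * (Pv * W))          ≡⟨ cong (λ t → (Pr * A) * t) (trans (cong (c *_) (sym (ℕtoℚ-* (p ^ v) w))) c-inverse) ⟩
    (Pr * A) * 1ℚ                      ≡⟨ *-identityʳ _ ⟩
    Pr * A                             ∎)
    where
    open ≡-Reasoning
    Pv Pr W B A : ℚ
    Pv = ℕtoℚ (p ^ v)
    Pr = ℕtoℚ (p ^ (e ∸ v))
    W = ℕtoℚ w
    B = ℕtoℚ b
    A = ℤtoℚ a
    split-p^e : ℕtoℚ (p ^ e) ≡ Pr * Pv
    split-p^e = trans (cong ℕtoℚ (trans (cong (p ^_) (sym (ℕ.m∸n+n≡m v≤e))) (ℕ.^-distribˡ-+-* p (e ∸ v) v)))
                      (ℕtoℚ-* (p ^ (e ∸ v)) (p ^ v))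

  ∣ₚ-cancel : ∀ {e y} w → ¬ p ∣ w → p^ e ∣ₚ (y * ℕtoℚ w) → p^ e ∣ₚ y
  ∣ₚ-cancel {e} {y} w p∤w (witness a b p∤b ey) = witness a (w ℕ.* b) (p∤-* p∤w p∤b)
    (trans (cong (y *_) (ℕtoℚ-* w b)) (trans (sym (*-assoc y (ℕtoℚ w) (ℕtoℚ b))) ey))

  ∣ₚ-sumQ : ∀ {e} n (f : ℕ → ℚ) → (∀ i → i < n → p^ e ∣ₚ f i) → p^ e ∣ₚ sumQ n f
  ∣ₚ-sumQ zero    f f∣ = ∣ₚ-0ℚ _
  ∣ₚ-sumQ (suc n) f f∣ = ∣ₚ-+ (∣ₚ-sumQ n f (λ i i<n → f∣ i (ℕ.m<n⇒m<1+n i<n))) (f∣ n (ℕ.n<1+n n))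

  ∣ₚ-δ : ∀ {e} a b {x} → p^ e ∣ₚ x → p^ e ∣ₚ δ a b x
  ∣ₚ-δ a b x∣ with a ℕ.≟ b
  ... | yes refl = subst (p^ _ ∣ₚ_) (sym (δ-refl a _)) x∣
  ... | no a≢b   = subst (p^ _ ∣ₚ_) (sym (δ-≢ _ a≢b)) (∣ₚ-0ℚ _)

  -- In lowest terms x = n/d: from n·b·1 = p^e·a·d and gcd(n, d) = 1 we get d ∣ p^e a b, hence p ∤ d, and p^e ∣ n·b.
  ∣ₚ⇒InPZ : ∀ {e x} → p^ e ∣ₚ x → InPZ p e x
  ∣ₚ⇒InPZ {e} {x@(ℚ.mkℚ _ _ n⊥d)} (witness a b p∤b ex) = p∤d , p^e∣n
    where
    c : ℤ
    c = + (p ^ e) ℤ.* a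
    cross : ↥ x ℤ.* + b ≡ c ℤ.* ↧ x
    cross = x*b≡c⇒↥x*b≡c*↧x x b c (trans ex (sym (ℤtoℚ-* (+ (p ^ e)) a)))
    in-ℕ : ℤ.∣ ↥ x ∣ ℕ.* b ≡ (p ^ e ℕ.* ℤ.∣ a ∣) ℕ.* ↧ₙ x
    in-ℕ = trans (sym (ℤ.abs-* (↥ x) (+ b))) (trans (cong ℤ.∣_∣ cross) (trans (ℤ.abs-* c (↧ x)) (cong (ℕ._* ↧ₙ x) (ℤ.abs-* (+ (p ^ e)) a))))
    p∤d : ¬ p ∣ ↧ₙ x
    p∤d p∣d = p∤b (ℕ.∣-trans p∣d (Coprime.coprime-divisor (Coprime.sym (Coprime.recompute n⊥d)) (divides (p ^ e ℕ.* ℤ.∣ a ∣) in-ℕ)))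
    p^e∣n : p ^ e ∣ ℤ.∣ ↥ x ∣
    p^e∣n = p^e∣m*b⇒p^e∣m e ℤ.∣ ↥ x ∣ b p∤b (divides (ℤ.∣ a ∣ ℕ.* ↧ₙ x)
      (trans in-ℕ (trans (ℕ.*-assoc (p ^ e) ℤ.∣ a ∣ (↧ₙ x)) (ℕ.*-comm (p ^ e) (ℤ.∣ a ∣ ℕ.* ↧ₙ x)))))

  p^_∣ₛ_ : ℕ → PS → Set
  p^ e ∣ₛ f = ∀ n → p^ e ∣ₚ f n

  ∣ₛ⇒ValGe : ∀ {e f} → p^ e ∣ₛ f → ValGe p e f
  ∣ₛ⇒ValGe f∣ n = ∣ₚ⇒InPZ (f∣ n)

  ∣ₛ-cong : ∀ {e f g} → f ≗ g → p^ e ∣ₛ f → p^ e ∣ₛ g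
  ∣ₛ-cong f≗g f∣ n = subst (p^ _ ∣ₚ_) (f≗g n) (f∣ n)

  ∣ₛ-weaken : ∀ {e e′ f} → e′ ≤ e → p^ e ∣ₛ f → p^ e′ ∣ₛ f
  ∣ₛ-weaken e′≤e f∣ n = ∣ₚ-weaken e′≤e (f∣ n)

  ∣ₛ-addS : ∀ {e f g} → p^ e ∣ₛ f → p^ e ∣ₛ g → p^ e ∣ₛ addS f g
  ∣ₛ-addS f∣ g∣ n = ∣ₚ-+ (f∣ n) (g∣ n)

  ∣ₛ-subS : ∀ {e f g} → p^ e ∣ₛ f → p^ e ∣ₛ g → p^ e ∣ₛ subS f g
  ∣ₛ-subS f∣ g∣ n = ∣ₚ-- (f∣ n) (g∣ n)

  ∣ₛ-scaleS : ∀ {e e′ c f} → p^ e′ ∣ₚ c → p^ e ∣ₛ f → p^ (e′ ℕ.+ e) ∣ₛ scaleS c f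
  ∣ₛ-scaleS c∣ f∣ n = ∣ₚ-* c∣ (f∣ n)

  ∣ₛ-mulS : ∀ {e e′ f g} → p^ e ∣ₛ f → p^ e′ ∣ₛ g → p^ (e ℕ.+ e′) ∣ₛ mulS f g
  ∣ₛ-mulS f∣ g∣ n = ∣ₚ-sumQ (suc n) _ (λ i _ → ∣ₚ-* (f∣ i) (g∣ (n ∸ i)))

  ∣ₛ-oneS : p^ 0 ∣ₛ oneS
  ∣ₛ-oneS zero    = ∣ₚ-ℕtoℚ 1
  ∣ₛ-oneS (suc n) = ∣ₚ-0ℚ 0

  ∣ₛ-powS : ∀ {e f} k → p^ e ∣ₛ f → p^ (k ℕ.* e) ∣ₛ powS f k
  ∣ₛ-powS zero    f∣ = ∣ₛ-oneS
  ∣ₛ-powS (suc k) f∣ = ∣ₛ-mulS f∣ (∣ₛ-powS k f∣)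

  ∣ₛ-powS₀ : ∀ {f} k → p^ 0 ∣ₛ f → p^ 0 ∣ₛ powS f k
  ∣ₛ-powS₀ {f} k f∣ = subst (p^_∣ₛ powS f k) (ℕ.*-zeroʳ k) (∣ₛ-powS k f∣)

  ∣ₛ-monoS : ∀ {c} m → p^ 0 ∣ₚ c → p^ 0 ∣ₛ monoS c m
  ∣ₛ-monoS m c∣ n = ∣ₚ-δ n m c∣

  ∣ₛ-shiftS : ∀ {e f} → p^ e ∣ₛ f → p^ e ∣ₛ shiftS f
  ∣ₛ-shiftS f∣ zero    = ∣ₚ-0ℚ _
  ∣ₛ-shiftS f∣ (suc n) = f∣ n

  ∣ₛ-substPow : ∀ {e f} d → p^ e ∣ₛ f → p^ e ∣ₛ substPow d f
  ∣ₛ-substPow d f∣ n = ∣ₚ-sumQ (suc n) _ (λ i _ → ∣ₚ-δ (d ℕ.* i) n (f∣ i))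

  ∣ₛ-invS : ∀ {f} → p^ 0 ∣ₛ f → p^ 0 ∣ₛ invS f
  ∣ₛ-invS {f} f∣ = <-rec (λ m → p^ 0 ∣ₚ invS f m) step
    where
    step : ∀ m → (∀ {i} → i < m → p^ 0 ∣ₚ invS f i) → p^ 0 ∣ₚ invS f m
    step zero    _     = ∣ₚ-ℕtoℚ 1
    step (suc m) below = subst (p^ 0 ∣ₚ_) (sym (invS-rec f m))
      (∣ₚ-neg (∣ₚ-sumQ (suc m) _ (λ j _ → ∣ₚ-* (f∣ (suc j)) (below (s≤s (ℕ.m∸n≤m m j))))))

  ∣ₛ-subS-≗ : ∀ {e f g} → f ≗ g → p^ e ∣ₛ subS f g
  ∣ₛ-subS-≗ {e} {f} {g} f≗g n = subst (p^ e ∣ₚ_) (sym (trans (cong (_- g n) (f≗g n)) (+-inverseʳ (g n)))) (∣ₚ-0ℚ e)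

module Frobenius (p : ℕ) (p-prime : Prime p) where

  open import Defs
  open import Data.Nat as ℕ using (zero; suc; _≤_; _<_; _∸_; _^_; _!; z≤n; s≤s)
  import Data.Nat.Properties as ℕ
  open import Data.Integer using (+_; -[1+_])
  open import Data.Rational using (ℚ; 0ℚ; 1ℚ; _+_; _*_; -_; _-_)
  open import Data.Rational.Properties using (+-identityˡ; +-identityʳ; +-inverseˡ; *-identityˡ; *-identityʳ; *-zeroˡ; *-zeroʳ; *-assoc)
  open import Data.Nat.Induction using (<-rec)
  open import Data.Rational.Solver using (module +-*-Solver)
  open import Relation.Nullary using (yes; no)
  open import Relation.Binary.PropositionalEquality
  open RationalArithmetic
  open FiniteSums
  open PowerSeriesRing
  open Substitution
  open SeriesInX
  open PrimeDivisibility p p-prime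
  open PAdic p p-prime

  open +-*-Solver

  binomial-divisible : ∀ i → 0 < i → i < p → p^ 1 ∣ₚ (ℕtoℚ (p !) * invFact i * invFact (p ∸ i))
  binomial-divisible i 0<i i<p =
    witness (+ ((p ∸ 1) !)) (i ! ℕ.* (p ∸ i) !) (p∤-* (p∤k! i i<p) (p∤k! (p ∸ i) (ℕ.∸-monoʳ-< 0<i (ℕ.<⇒≤ i<p)))) (begin
      P * a * b * ℕtoℚ (i ! ℕ.* (p ∸ i) !)      ≡⟨ cong (P * a * b *_) (ℕtoℚ-* (i !) ((p ∸ i) !)) ⟩
      P * a * b * (A * B)                       ≡⟨ solve 5 (λ P a b A B → P :* a :* b :* (A :* B) := P :* (A :* a) :* (B :* b)) refl P a b A B ⟩
      P * (A * a) * (B * b)                     ≡⟨ cong₂ (λ s t → P * s * t) (invFact-inverse i) (invFact-inverse (p ∸ i)) ⟩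
      P * 1ℚ * 1ℚ                               ≡⟨ trans (*-identityʳ _) (*-identityʳ P) ⟩
      ℕtoℚ (p !)                                ≡⟨ cong (λ t → ℕtoℚ (t !)) p≡1+[p∸1] ⟩
      ℕtoℚ (suc (p ∸ 1) !)                      ≡⟨ ℕtoℚ-* (suc (p ∸ 1)) ((p ∸ 1) !) ⟩
      ℕtoℚ (suc (p ∸ 1)) * ℕtoℚ ((p ∸ 1) !)     ≡⟨ cong (λ t → ℕtoℚ t * ℕtoℚ ((p ∸ 1) !)) (trans (sym p≡1+[p∸1]) (sym (ℕ.*-identityʳ p))) ⟩
      ℕtoℚ (p ^ 1) * ℕtoℚ ((p ∸ 1) !)           ∎)
    where
    open ≡-Reasoning
    P a b A B : ℚ
    P = ℕtoℚ (p !)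
    a = invFact i
    b = invFact (p ∸ i)
    A = ℕtoℚ (i !)
    B = ℕtoℚ ((p ∸ i) !)

  binomial-term : ∀ A B i k n → ℕtoℚ (p !) * mulS (dividedPower i A) (dividedPower k B) n ≡
                  (ℕtoℚ (p !) * invFact i * invFact k) * mulS (powS A i) (powS B k) n
  binomial-term A B i k n = trans (cong (ℕtoℚ (p !) *_)
    (trans (mulS-scaleˡ (invFact i) (powS A i) (dividedPower k B) n) (cong (invFact i *_) (mulS-scaleʳ (invFact k) (powS A i) (powS B k) n))))
    (solve 4 (λ P a b M → P :* (a :* (b :* M)) := P :* a :* b :* M) refl (ℕtoℚ (p !)) (invFact i) (invFact k) _)

  -- (A + B)^p = p!·(A + B)^p/p! expands into the binomial sum, whose two end terms are A^p and B^p.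
  freshmans-dream : ∀ {A B} → p^ 0 ∣ₛ A → p^ 0 ∣ₛ B → p^ 1 ∣ₛ subS (powS (addS A B) p) (addS (powS A p) (powS B p))
  freshmans-dream {A} {B} A∣ B∣ n = subst (p^ 1 ∣ₚ_) (sym difference≡middle) middle∣
    where
    F : ℕ → ℚ
    F i = ℕtoℚ (p !) * mulS (dividedPower i A) (dividedPower (p ∸ i) B) n
    middle : ℚ
    middle = sumQ (p ∸ 1) (λ i → F (suc i))
    first : F 0 ≡ powS B p n
    first = trans (binomial-term A B 0 p n)
      (trans (cong₂ _*_ (trans (cong (_* invFact p) (*-identityʳ (ℕtoℚ (p !)))) (invFact-inverse p)) (mulS-identityˡ (powS B p) n))
             (*-identityˡ (powS B p n)))
    last : F p ≡ powS A p n
    last = trans (cong (λ t → ℕtoℚ (p !) * mulS (dividedPower p A) (dividedPower t B) n) (ℕ.n∸n≡0 p))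
      (trans (binomial-term A B p 0 n)
      (trans (cong₂ _*_ (trans (*-identityʳ _) (invFact-inverse p)) (mulS-identityʳ (powS A p) n)) (*-identityˡ (powS A p n))))
    expansion : powS (addS A B) p n ≡ F 0 + (middle + F p)
    expansion = begin
      powS (addS A B) p n                                    ≡⟨ trans (cong (_* powS (addS A B) p n) (invFact-inverse p)) (*-identityˡ _) ⟨
      ℕtoℚ (p !) * invFact p * powS (addS A B) p n           ≡⟨ *-assoc (ℕtoℚ (p !)) (invFact p) _ ⟩
      ℕtoℚ (p !) * dividedPower p (addS A B) n               ≡⟨ cong (ℕtoℚ (p !) *_) (binomialSum-dividedPower A B p n) ⟨
      ℕtoℚ (p !) * binomialSum A B p n                       ≡⟨ sumQ-*ˡ (suc p) (ℕtoℚ (p !)) _ ⟩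
      sumQ (suc p) F                                         ≡⟨ cong (λ t → sumQ (suc t) F) p≡1+[p∸1] ⟩
      sumQ (suc (suc (p ∸ 1))) F                             ≡⟨ sumQ-head (suc (p ∸ 1)) F ⟩
      F 0 + (middle + F (suc (p ∸ 1)))                       ≡⟨ cong (λ t → F 0 + (middle + F t)) p≡1+[p∸1] ⟨
      F 0 + (middle + F p)                                   ∎
      where open ≡-Reasoning
    difference≡middle : subS (powS (addS A B) p) (addS (powS A p) (powS B p)) n ≡ middle
    difference≡middle = trans (cong (_- (powS A p n + powS B p n)) (trans expansion (cong₂ (λ s t → s + (middle + t)) first last)))
      (solve 3 (λ b m a → b :+ (m :+ a) :- (a :+ b) := m) refl (powS B p n) middle (powS A p n))
    middle∣ : p^ 1 ∣ₚ middle
    middle∣ = ∣ₚ-sumQ (p ∸ 1) _ (λ i i<p-1 → subst (p^ 1 ∣ₚ_) (sym (binomial-term A B (suc i) (p ∸ suc i) n))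
      (∣ₚ-*ʳ (binomial-divisible (suc i) (s≤s z≤n) (subst (suc (suc i) ≤_) (sym p≡1+[p∸1]) (s≤s i<p-1)))
             (∣ₛ-mulS (∣ₛ-powS₀ (suc i) A∣) (∣ₛ-powS₀ (p ∸ suc i) B∣) n)))

  constS : ℚ → PS
  constS c = scaleS c oneS

  ∣ₛ-constS : ∀ {c} → p^ 0 ∣ₚ c → p^ 0 ∣ₛ constS c
  ∣ₛ-constS c∣ = ∣ₛ-scaleS c∣ ∣ₛ-oneS

  powS-constS-0 : ∀ c k → powS (constS c) k 0 ≡ powQ c k
  powS-constS-0 c k = trans (powS-0 (constS c) k) (cong (λ t → powQ t k) (*-identityʳ c))

  freshmans-dreamℚ : ∀ {x y} → p^ 0 ∣ₚ x → p^ 0 ∣ₚ y → p^ 1 ∣ₚ (powQ (x + y) p - (powQ x p + powQ y p))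
  freshmans-dreamℚ {x} {y} x∣ y∣ = subst (p^ 1 ∣ₚ_) at-0 (freshmans-dream (∣ₛ-constS x∣) (∣ₛ-constS y∣) 0)
    where
    at-0 : subS (powS (addS (constS x) (constS y)) p) (addS (powS (constS x) p) (powS (constS y) p)) 0 ≡
           powQ (x + y) p - (powQ x p + powQ y p)
    at-0 = cong₂ _-_ (trans (powS-0 (addS (constS x) (constS y)) p) (cong (λ t → powQ t p) (cong₂ _+_ (*-identityʳ x) (*-identityʳ y))))
                     (cong₂ _+_ (powS-constS-0 x p) (powS-constS-0 y p))

  powQ-0ℚ : powQ 0ℚ p ≡ 0ℚ
  powQ-0ℚ = trans (cong (powQ 0ℚ) p≡1+[p∸1]) (*-zeroˡ (powQ 0ℚ (p ∸ 1)))

  fermat-ℕ : ∀ a → p^ 1 ∣ₚ (powQ (ℕtoℚ a) p - ℕtoℚ a)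
  fermat-ℕ zero    = subst (p^ 1 ∣ₚ_) (sym (cong (_- 0ℚ) powQ-0ℚ)) (∣ₚ-0ℚ 1)
  fermat-ℕ (suc a) = subst (p^ 1 ∣ₚ_) (sym regroup)
    (∣ₚ-+ (∣ₚ-+ (freshmans-dreamℚ (∣ₚ-ℕtoℚ 1) (∣ₚ-ℕtoℚ a)) (fermat-ℕ a))
          (subst (p^ 1 ∣ₚ_) (sym (cong (_- 1ℚ) (powQ-1ℚ p))) (∣ₚ-0ℚ 1)))
    where
    X : ℚ
    X = ℕtoℚ a
    regroup : powQ (ℕtoℚ (suc a)) p - ℕtoℚ (suc a) ≡
              (powQ (1ℚ + X) p - (powQ 1ℚ p + powQ X p)) + (powQ X p - X) + (powQ 1ℚ p - 1ℚ)
    regroup = trans (cong (λ s → powQ s p - s) (ℕtoℚ-suc a))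
      (solve 4 (λ Y O Z X → Y :- (con 1ℚ :+ X) := (Y :- (O :+ Z)) :+ (Z :- X) :+ (O :- con 1ℚ)) refl
               (powQ (1ℚ + X) p) (powQ 1ℚ p) (powQ X p) X)

  -- For negative z use (-X)^p + X^p ≡ (-X + X)^p = 0.
  fermat-ℤ : ∀ z → p^ 1 ∣ₚ (powQ (ℤtoℚ z) p - ℤtoℚ z)
  fermat-ℤ (+ a)    = fermat-ℕ a
  fermat-ℤ -[1+ a ] = subst (p^ 1 ∣ₚ_) (sym regroup)
    (∣ₚ-- (∣ₚ-neg (freshmans-dreamℚ (∣ₚ-neg (∣ₚ-ℕtoℚ (suc a))) (∣ₚ-ℕtoℚ (suc a)))) (fermat-ℕ (suc a)))
    where
    X N Z : ℚ
    X = ℕtoℚ (suc a)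
    N = powQ (- X) p
    Z = powQ X p
    regroup : powQ (ℤtoℚ -[1+ a ]) p - ℤtoℚ -[1+ a ] ≡ - (powQ (- X + X) p - (N + Z)) - (Z - X)
    regroup = trans (cong (λ t → powQ t p - t) (ℤtoℚ-neg (+ suc a)))
      (trans (solve 3 (λ N Z X → N :- (:- X) := :- (con 0ℚ :- (N :+ Z)) :- (Z :- X)) refl N Z X)
             (cong (λ t → - (t - (N + Z)) - (Z - X)) (sym (trans (cong (λ t → powQ t p) (+-inverseˡ X)) powQ-0ℚ))))

  -- Clear the denominator: with x b = a, (x^p - x) b = (a^p - a) - x^p (b^p - b).
  fermat : ∀ {x} → p^ 0 ∣ₚ x → p^ 1 ∣ₚ (powQ x p - x)
  fermat {x} x∣@(witness a b p∤b xb≡a) = ∣ₚ-cancel b p∤b (subst (p^ 1 ∣ₚ_) (sym regroup)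
    (∣ₚ-- (fermat-ℤ a) (∣ₚ-* (∣ₚ-powQ p x∣) (fermat-ℕ b))))
    where
    B A : ℚ
    B = ℕtoℚ b
    A = ℤtoℚ a
    xB≡A : x * B ≡ A
    xB≡A = trans xb≡a (*-identityˡ A)
    regroup : (powQ x p - x) * B ≡ (powQ A p - A) - powQ x p * (powQ B p - B)
    regroup = trans (solve 4 (λ xp x B Bp → (xp :- x) :* B := (xp :* Bp :- x :* B) :- xp :* (Bp :- B)) refl (powQ x p) x B (powQ B p))
      (cong₂ (λ s t → (s - t) - powQ x p * (powQ B p - B)) (trans (sym (powQ-* x B p)) (cong (λ t → powQ t p) xB≡A)) xB≡A)

  tailS : PS → PS
  tailS f i = f (suc i)

  constS-+-shiftS : ∀ f → f ≗ addS (constS (f 0)) (shiftS (tailS f))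
  constS-+-shiftS f zero    = sym (trans (cong (_+ 0ℚ) (*-identityʳ (f 0))) (+-identityʳ (f 0)))
  constS-+-shiftS f (suc n) = sym (trans (cong (_+ f (suc n)) (*-zeroʳ (f 0))) (+-identityˡ (f (suc n))))

  FrobeniusAt : ℕ → Set
  FrobeniusAt n = ∀ f → p^ 0 ∣ₛ f → p^ 1 ∣ₚ (powS f p n - substPow p f n)

  -- With f = c + q g, the dream gives f^p ≡ c^p + q^p g^p, Fermat gives c^p ≡ c, and g^p ≡ g(q^p)
  -- is the same congruence at the smaller index n - p.
  frobenius-step : ∀ n → (∀ {m} → m < n → FrobeniusAt m) → FrobeniusAt n
  frobenius-step n smaller f f∣ = subst (p^ 1 ∣ₚ_) (sym regroup) (∣ₚ-+ (∣ₚ-+ dream∣ constant∣) shifted∣)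
    where
    c : ℚ
    c = f 0
    g : PS
    g = tailS f
    g∣ : p^ 0 ∣ₛ g
    g∣ i = f∣ (suc i)
    Y K₁ S₁ K₂ S₂ : ℚ
    Y  = powS (addS (constS c) (shiftS g)) p n
    K₁ = powQ c p * oneS n
    S₁ = shiftBy p (powS g p) n
    K₂ = c * oneS n
    S₂ = shiftBy p (substPow p g) n
    powS-f : powS f p n ≡ Y
    powS-f = powS-cong p (constS-+-shiftS f) n
    substPow-f : substPow p f n ≡ K₂ + S₂
    substPow-f = trans (substPow-cong p (constS-+-shiftS f) n) (trans (substPow-addS p (constS c) (shiftS g) n)
      (cong₂ _+_ (trans (substPow-scaleS p c oneS n) (cong (c *_) (substPow-oneS p n))) (substPow-shiftS p g n)))
    dream∣ : p^ 1 ∣ₚ (Y - (K₁ + S₁))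
    dream∣ = subst (p^ 1 ∣ₚ_)
      (cong₂ (λ s t → Y - (s + t)) (trans (powS-scaleS c oneS p n) (cong (powQ c p *_) (powS-oneS p n))) (powS-shiftS g p n))
      (freshmans-dream (∣ₛ-constS (f∣ 0)) (∣ₛ-shiftS g∣) n)
    constant∣ : p^ 1 ∣ₚ (K₁ - K₂)
    constant∣ = subst (p^ 1 ∣ₚ_) (solve 3 (λ a b c → (a :- b) :* c := a :* c :- b :* c) refl (powQ c p) c (oneS n))
                  (∣ₚ-*ʳ (fermat (f∣ 0)) (∣ₛ-oneS n))
    shifted∣ : p^ 1 ∣ₚ (S₁ - S₂)
    shifted∣ with n ℕ.<? p
    ... | yes n<p = subst (p^ 1 ∣ₚ_) (sym (cong₂ _-_ (shiftBy-< p _ n n<p) (shiftBy-< p _ n n<p))) (∣ₚ-0ℚ 1)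
    ... | no n≮p  = subst (λ t → p^ 1 ∣ₚ (shiftBy p (powS g p) t - shiftBy p (substPow p g) t)) (ℕ.m+[n∸m]≡n (ℕ.≮⇒≥ n≮p))
      (subst (p^ 1 ∣ₚ_) (sym (cong₂ _-_ (shiftBy-+ p (powS g p) (n ∸ p)) (shiftBy-+ p (substPow p g) (n ∸ p))))
        (smaller (ℕ.∸-monoʳ-< {n} {p} {0} (ℕ.>-nonZero⁻¹ p) (ℕ.≮⇒≥ n≮p)) g g∣))
    regroup : powS f p n - substPow p f n ≡ (Y - (K₁ + S₁)) + (K₁ - K₂) + (S₁ - S₂)
    regroup = trans (cong₂ _-_ powS-f substPow-f)
      (solve 5 (λ Y K₁ S₁ K₂ S₂ → Y :- (K₂ :+ S₂) := (Y :- (K₁ :+ S₁)) :+ (K₁ :- K₂) :+ (S₁ :- S₂)) refl Y K₁ S₁ K₂ S₂)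

  frobenius : ∀ {f} → p^ 0 ∣ₛ f → p^ 1 ∣ₛ subS (powS f p) (substPow p f)
  frobenius {f} f∣ n = <-rec FrobeniusAt frobenius-step n f f∣

module Legendre (p : ℕ) (p-prime : Prime p) where

  open import Defs using (vp)
  open import Data.Nat as ℕ using (zero; suc; _≤_; _<_; _∸_; _^_; _!; z≤n; s≤s)
  import Data.Nat.Properties as ℕ
  open import Data.Nat.Divisibility as ℕ using (_∣_; divides)
  open import Data.Nat.Induction using (<-rec)
  open import Data.Nat.Solver using (module +-*-Solver)
  open import Data.Empty using (⊥-elim)
  open import Data.Sum using (_⊎_; inj₁; inj₂)
  open import Relation.Nullary using (¬_; yes; no)
  open import Relation.Binary.PropositionalEquality
  open Valuation
  open PrimeDivisibility p p-prime

  open +-*-Solver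

  -- a = ⌊k/p⌋: the multiples p, 2p, …, ap up to k contribute p^a · a! to k!.
  record FactorialSplit (k : ℕ) : Set where
    field
      a u      : ℕ
      split    : k ! ≡ p ^ a ℕ.* (a ! ℕ.* u)
      p∤u      : ¬ p ∣ u
      pa≤k     : p ℕ.* a ≤ k
      k<p[1+a] : k < p ℕ.* suc a

  factorial-split : ∀ k → FactorialSplit k
  factorial-split zero = record
    { a = 0 ; u = 1 ; split = refl ; p∤u = p∤1
    ; pa≤k = ℕ.≤-reflexive (ℕ.*-zeroʳ p) ; k<p[1+a] = subst (0 <_) (sym (ℕ.*-identityʳ p)) (ℕ.>-nonZero⁻¹ p) }
  factorial-split (suc k) with factorial-split k
  ... | record { a = a ; u = u ; split = split ; p∤u = p∤u ; pa≤k = pa≤k ; k<p[1+a] = k<p[1+a] } with suc k ℕ.≟ p ℕ.* suc a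
  ...   | yes 1+k≡p[1+a] = record
    { a = suc a ; u = u ; p∤u = p∤u ; pa≤k = ℕ.≤-reflexive (sym 1+k≡p[1+a])
    ; split = trans (cong₂ ℕ._*_ 1+k≡p[1+a] split)
        (solve 5 (λ P A Pa Af U → (P :* A) :* (Pa :* (Af :* U)) := (P :* Pa) :* ((A :* Af) :* U)) refl p (suc a) (p ^ a) (a !) u)
    ; k<p[1+a] = subst (_< p ℕ.* suc (suc a)) (sym 1+k≡p[1+a]) (ℕ.*-monoʳ-< p (ℕ.n<1+n (suc a))) }
  ...   | no 1+k≢p[1+a] = record
    { a = a ; u = suc k ℕ.* u ; p∤u = p∤-* p∤1+k p∤u ; pa≤k = ℕ.m≤n⇒m≤1+n pa≤k
    ; split = trans (cong (suc k ℕ.*_) split)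
        (solve 4 (λ K Pa Af U → K :* (Pa :* (Af :* U)) := Pa :* (Af :* (K :* U))) refl (suc k) (p ^ a) (a !) u)
    ; k<p[1+a] = 1+k<p[1+a] }
    where
    1+k<p[1+a] : suc k < p ℕ.* suc a
    1+k<p[1+a] = ℕ.≤∧≢⇒< k<p[1+a] 1+k≢p[1+a]
    p∤1+k : ¬ p ∣ suc k
    p∤1+k (divides c 1+k≡c*p) = ℕ.<-irrefl refl (ℕ.≤-trans (s≤s cp≤k) (ℕ.≤-reflexive 1+k≡c*p))
      where
      c<1+a : c < suc a
      c<1+a = ℕ.*-cancelʳ-< p c (suc a) (subst (_< suc a ℕ.* p) 1+k≡c*p (subst (suc k <_) (ℕ.*-comm p (suc a)) 1+k<p[1+a]))
      cp≤k : c ℕ.* p ≤ k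
      cp≤k = ℕ.≤-trans (ℕ.*-monoˡ-≤ p (ℕ.≤-pred c<1+a)) (subst (_≤ k) (ℕ.*-comm p a) pa≤k)

  p*a≡[p∸1]*a+a : ∀ a → p ℕ.* a ≡ (p ∸ 1) ℕ.* a ℕ.+ a
  p*a≡[p∸1]*a+a a = trans (cong (ℕ._* a) p≡1+[p∸1]) (ℕ.+-comm a ((p ∸ 1) ℕ.* a))

  p^r∣a!⇒a<p*a : ∀ a r → 0 < r → p ^ r ∣ a ! → a < p ℕ.* a
  p^r∣a!⇒a<p*a zero    (suc r) _ p^r∣1 = ⊥-elim (p∤1 (ℕ.∣-trans (ℕ.m∣m*n (p ^ r)) p^r∣1))
  p^r∣a!⇒a<p*a (suc a) r       _ _     = subst (_< p ℕ.* suc a) (ℕ.*-identityˡ (suc a)) (ℕ.*-monoˡ-< (suc a) 1<p)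

  LegendreAt : ℕ → Set
  LegendreAt k = ∀ w → p ^ w ∣ k ! → w ≡ 0 ⊎ (p ∸ 1) ℕ.* w ℕ.+ 1 ≤ k

  -- If p^(w+1) ∣ k! = p^a a! u with w + 1 > a, then p^(w+1-a) ∣ a! and a < k, so induction applies to a.
  legendre-step : ∀ k → (∀ {a} → a < k → LegendreAt a) → LegendreAt k
  legendre-step k smaller zero    _ = inj₁ refl
  legendre-step k smaller (suc w) p^[1+w]∣k! with factorial-split k
  ... | record { a = a ; u = u ; split = split ; p∤u = p∤u ; pa≤k = pa≤k } with suc w ℕ.≤? a
  ...   | yes 1+w≤a = inj₂ (begin
    (p ∸ 1) ℕ.* suc w ℕ.+ 1   ≤⟨ ℕ.+-mono-≤ (ℕ.*-monoʳ-≤ (p ∸ 1) 1+w≤a) (ℕ.≤-trans (s≤s z≤n) 1+w≤a) ⟩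
    (p ∸ 1) ℕ.* a ℕ.+ a       ≡⟨ p*a≡[p∸1]*a+a a ⟨
    p ℕ.* a                   ≤⟨ pa≤k ⟩
    k                         ∎)
    where open ℕ.≤-Reasoning
  ...   | no 1+w≰a = inj₂ (bound (smaller a<k r p^r∣a!))
    where
    a<1+w : a < suc w
    a<1+w = ℕ.≰⇒> 1+w≰a
    r : ℕ
    r = suc w ∸ a
    0<r : 0 < r
    0<r = ℕ.m<n⇒0<n∸m a<1+w
    p^r∣a! : p ^ r ∣ a !
    p^r∣a! = p^e∣m*b⇒p^e∣m r (a !) u p∤u (ℕ.*-cancelˡ-∣ (p ^ a) {{ℕ.m^n≢0 p a}}
      (subst₂ _∣_ (trans (cong (p ^_) (sym (ℕ.m+[n∸m]≡n (ℕ.<⇒≤ a<1+w)))) (ℕ.^-distribˡ-+-* p a r)) split p^[1+w]∣k!))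
    a<k : a < k
    a<k = ℕ.<-≤-trans (p^r∣a!⇒a<p*a a r 0<r p^r∣a!) pa≤k
    bound : r ≡ 0 ⊎ (p ∸ 1) ℕ.* r ℕ.+ 1 ≤ a → (p ∸ 1) ℕ.* suc w ℕ.+ 1 ≤ k
    bound (inj₁ r≡0) = ⊥-elim (ℕ.<-irrefl (sym r≡0) 0<r)
    bound (inj₂ r-bound) = begin
      (p ∸ 1) ℕ.* suc w ℕ.+ 1                        ≡⟨ cong (λ t → (p ∸ 1) ℕ.* t ℕ.+ 1) (ℕ.m+[n∸m]≡n (ℕ.<⇒≤ a<1+w)) ⟨
      (p ∸ 1) ℕ.* (a ℕ.+ r) ℕ.+ 1                    ≡⟨ solve 3 (λ c a r → c :* (a :+ r) :+ con 1 := c :* a :+ (c :* r :+ con 1)) refl (p ∸ 1) a r ⟩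
      (p ∸ 1) ℕ.* a ℕ.+ ((p ∸ 1) ℕ.* r ℕ.+ 1)        ≤⟨ ℕ.+-monoʳ-≤ ((p ∸ 1) ℕ.* a) r-bound ⟩
      (p ∸ 1) ℕ.* a ℕ.+ a                            ≡⟨ p*a≡[p∸1]*a+a a ⟨
      p ℕ.* a                                        ≤⟨ pa≤k ⟩
      k                                              ∎
      where open ℕ.≤-Reasoning

  legendre-bound : ∀ k → (p ∸ 1) ℕ.* vp p (k !) ≤ k ∸ 1
  legendre-bound k with <-rec LegendreAt legendre-step k (vp p (k !)) (vp-∣ p (k !))
  ... | inj₁ v≡0  = subst (λ v → (p ∸ 1) ℕ.* v ≤ k ∸ 1) (sym v≡0) (subst (_≤ k ∸ 1) (sym (ℕ.*-zeroʳ (p ∸ 1))) z≤n)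
  ... | inj₂ bound = ℕ.m+n≤o⇒m≤o∸n ((p ∸ 1) ℕ.* vp p (k !)) bound

  vp-factorial-≤ : ∀ k → vp p (k !) ≤ k
  vp-factorial-≤ k = ℕ.≤-trans (ℕ.m≤n*m (vp p (k !)) (p ∸ 1) {{p∸1≢0}}) (ℕ.≤-trans (legendre-bound k) (ℕ.m∸n≤m k 1))
    where
    p∸1≢0 : ℕ.NonZero (p ∸ 1)
    p∸1≢0 = ℕ.>-nonZero (ℕ.m<n⇒0<n∸m 1<p)

module PAdicLog (p : ℕ) (p-prime : Prime p) where

  open import Defs
  open import Data.Nat as ℕ using (zero; suc; _≤_; _<_; _∸_; _^_; _!; z≤n; s≤s)
  import Data.Nat.Divisibility as ℕ
  import Data.Nat.Properties as ℕ
  open import Data.Product using (_,_)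
  open import Data.Rational using (ℚ; 0ℚ; 1ℚ; _+_; _*_; -_; _-_)
  open import Data.Rational.Properties using (*-comm; *-assoc; *-zeroʳ)
  open import Data.Rational.Solver using (module +-*-Solver)
  open import Relation.Binary.PropositionalEquality
  import Data.Nat.Solver as ℕSolver
  open RationalArithmetic
  open FiniteSums
  open PowerSeriesRing
  open LogExp
  open SeriesInX
  open Valuation
  open PrimeDivisibility p p-prime
  open PAdic p p-prime
  open Legendre p p-prime

  open +-*-Solver

  ∣ₚ-invFact : ∀ j → j < p → p^ 0 ∣ₚ invFact j
  ∣ₚ-invFact j j<p = ∣ₚ-unit (invFact j) (j !) (trans (*-comm (invFact j) _) (invFact-inverse j)) (p∤k! j j<p)

  -- 1/(j+1) loses v_p(j+1) ≤ j powers of p, so the j-th term of log keeps at least one.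
  ∣ₚ-logCoeff : ∀ j {y} → p^ (suc j) ∣ₚ y → p^ 1 ∣ₚ (logCoeff j * y)
  ∣ₚ-logCoeff j {y} y∣ with vp-decomposition (suc j) (s≤s z≤n)
  ... | w , 1+j≡p^v*w , p∤w = subst (p^ 1 ∣ₚ_) reorder
    (∣ₚ-weaken 1≤1+j∸v (∣ₚ-* (∣ₚ-powQ j (∣ₚ-neg (∣ₚ-ℕtoℚ 1))) (∣ₚ-divide (invSuc j) v w inverse p∤w v≤1+j y∣)))
    where
    v : ℕ
    v = vp p (suc j)
    v≤j : v ≤ j
    v≤j = ℕ.≤-pred (ℕ.<-≤-trans (n<m^n p 1<p v) (ℕ.≤-trans (ℕ.m≤m*n (p ^ v) w {{ℕ.≢-nonZero p∤w≢0}}) (ℕ.≤-reflexive (sym 1+j≡p^v*w))))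
      where
      p∤w≢0 : w ≢ 0
      p∤w≢0 refl = p∤w (p ℕ.∣0)
    v≤1+j : v ≤ suc j
    v≤1+j = ℕ.m≤n⇒m≤1+n v≤j
    1≤1+j∸v : 1 ≤ suc j ∸ v
    1≤1+j∸v = subst (1 ≤_) (sym (ℕ.+-∸-assoc 1 v≤j)) (s≤s z≤n)
    inverse : invSuc j * ℕtoℚ (p ^ v ℕ.* w) ≡ 1ℚ
    inverse = trans (cong (λ t → invSuc j * ℕtoℚ t) (sym 1+j≡p^v*w)) (trans (*-comm (invSuc j) _) (invSuc-inverse j))
    reorder : powQ (- 1ℚ) j * (y * invSuc j) ≡ logCoeff j * y
    reorder = solve 3 (λ a y b → a :* (y :* b) := a :* b :* y) refl (powQ (- 1ℚ) j) y (invSuc j)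

  ∣ₛ-logS : ∀ {f} → p^ 1 ∣ₛ subS f oneS → p^ 1 ∣ₛ logS f
  ∣ₛ-logS {f} f-1∣ n = ∣ₚ-sumQ n _ (λ j _ → ∣ₚ-logCoeff j (subst (λ e → p^ e ∣ₚ powS (subS f oneS) (suc j) n) (ℕ.*-identityʳ (suc j)) (∣ₛ-powS (suc j) f-1∣ n)))

  ∣ₛ-dividedPower : ∀ k {L} → p^ 1 ∣ₛ L → p^ (k ∸ vp p (k !)) ∣ₛ dividedPower k L
  ∣ₛ-dividedPower k {L} L∣ n with vp-decomposition (k !) (ℕ.1≤n! k)
  ... | w , k!≡p^v*w , p∤w = subst (p^ _ ∣ₚ_) (*-comm (powS L k n) (invFact k))
    (∣ₚ-divide (invFact k) (vp p (k !)) w inverse p∤w (vp-factorial-≤ k) Lᵏ∣)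
    where
    Lᵏ∣ : p^ k ∣ₚ powS L k n
    Lᵏ∣ = subst (λ e → p^ e ∣ₚ powS L k n) (ℕ.*-identityʳ k) (∣ₛ-powS k L∣ n)
    inverse : invFact k * ℕtoℚ (p ^ vp p (k !) ℕ.* w) ≡ 1ℚ
    inverse = trans (cong (λ t → invFact k * ℕtoℚ t) (sym k!≡p^v*w)) (trans (*-comm (invFact k) _) (invFact-inverse k))

  4≤k∸v : ∀ {c k v} → 4 ≤ c → c ℕ.* v ≤ k ∸ 1 → 4 ≤ k → 4 ≤ k ∸ v
  4≤k∸v {c} {k} {zero}  _   _    4≤k = 4≤k
  4≤k∸v {c} {k} {suc v} 4≤c cv≤k 4≤k = ℕ.m+n≤o⇒m≤o∸n 4 (begin
    4 ℕ.+ suc v                  ≤⟨ ℕ.m≤m+n (4 ℕ.+ suc v) (3 ℕ.* v) ⟩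
    4 ℕ.+ suc v ℕ.+ 3 ℕ.* v      ≡⟨ solveℕ 1 (λ v → conℕ 4 ⊕ (conℕ 1 ⊕ v) ⊕ conℕ 3 ⊛ v ≐ conℕ 4 ⊛ (conℕ 1 ⊕ v) ⊕ conℕ 1) refl v ⟩
    4 ℕ.* suc v ℕ.+ 1            ≤⟨ ℕ.+-monoˡ-≤ 1 (ℕ.≤-trans (ℕ.*-monoˡ-≤ (suc v) 4≤c) cv≤k) ⟩
    k ∸ 1 ℕ.+ 1                  ≡⟨ ℕ.m∸n+n≡m (ℕ.≤-trans (s≤s z≤n) 4≤k) ⟩
    k                            ∎)
    where
    open ℕ.≤-Reasoning
    open ℕSolver.+-*-Solver using () renaming (solve to solveℕ; con to conℕ; _:+_ to _⊕_; _:*_ to _⊛_; _:=_ to _≐_)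

  ∣ₛ-dividedPower-≥4 : 5 ≤ p → ∀ k {L} → 4 ≤ k → p^ 1 ∣ₛ L → p^ 4 ∣ₛ dividedPower k L
  ∣ₛ-dividedPower-≥4 5≤p k 4≤k L∣ = ∣ₛ-weaken (4≤k∸v (ℕ.∸-monoˡ-≤ 1 5≤p) (legendre-bound k) 4≤k) (∣ₛ-dividedPower k L∣)

  ∣ₛ-dividedPower-< : ∀ k {V} → k < p → p^ 0 ∣ₛ V → p^ 0 ∣ₛ dividedPower k V
  ∣ₛ-dividedPower-< k k<p V∣ = ∣ₛ-scaleS (∣ₚ-invFact k k<p) (∣ₛ-powS₀ k V∣)

  ∣ₛ-signedDividedPower : ∀ {e c V} k → p^ 0 ∣ₚ c → p^ e ∣ₛ dividedPower k V → p^ e ∣ₛ scaleS (powQ c k * invFact k) (powS V k)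
  ∣ₛ-signedDividedPower {c = c} {V} k c∣ V∣ n =
    subst (p^ _ ∣ₚ_) (sym (*-assoc (powQ c k) (invFact k) (powS V k n))) (∣ₚ-* (∣ₚ-powQ k c∣) (V∣ n))

  truncatedExp : ℚ → PS → PS
  truncatedExp c V = sumS 4 (λ l → scaleS (powQ c l * invFact l) (powS V l))

  ∣ₛ-truncatedExp : 4 ≤ p → ∀ {c V} → p^ 0 ∣ₚ c → p^ 0 ∣ₛ V → p^ 0 ∣ₛ truncatedExp c V
  ∣ₛ-truncatedExp 4≤p c∣ V∣ n = ∣ₚ-sumQ 4 _ (λ l l<4 →
    ∣ₛ-signedDividedPower l c∣ (∣ₛ-dividedPower-< l (ℕ.<-≤-trans l<4 4≤p) V∣) n)

  -- exp(cV) - Σ_{l<4} (cV)^l/l! = Σ_{k≥4} c^k V^k/k!, and each V^k/k! is divisible by p^4.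
  ∣ₛ-expS-truncation : 5 ≤ p → ∀ {c V} → V 0 ≡ 0ℚ → p^ 0 ∣ₚ c → p^ 1 ∣ₛ V → p^ 4 ∣ₛ subS (expS (scaleS c V)) (truncatedExp c V)
  ∣ₛ-expS-truncation 5≤p {c} {V} V₀≡0 c∣ V∣ n = subst (p^ 4 ∣ₚ_) (sym difference≡tail)
    (∣ₚ-sumQ n _ (λ i _ → subst (p^ 4 ∣ₚ_) (sym (F≡ (4 ℕ.+ i)))
      (∣ₛ-signedDividedPower {V = V} (4 ℕ.+ i) c∣ (∣ₛ-dividedPower-≥4 5≤p (4 ℕ.+ i) (ℕ.m≤m+n 4 i) V∣) n)))
    where
    F : ℕ → ℚ
    F k = invFact k * powS (scaleS c V) k n
    F≡ : ∀ k → F k ≡ (powQ c k * invFact k) * powS V k n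
    F≡ k = trans (cong (invFact k *_) (powS-scaleS c V k n))
      (solve 3 (λ a b x → a :* (b :* x) := b :* a :* x) refl (invFact k) (powQ c k) (powS V k n))
    difference≡tail : expS (scaleS c V) n - truncatedExp c V n ≡ sumQ n (λ i → F (4 ℕ.+ i))
    difference≡tail = trans (cong₂ _-_
        (trans (expS-partial (scaleS c V) n (4 ℕ.+ n) (trans (cong (c *_) V₀≡0) (*-zeroʳ c)) (ℕ.m≤n+m (suc n) 3)) (sumQ-split 4 n F))
        (sym (sumQ-cong 4 F≡)))
      (solve 2 (λ A R → A :+ R :- A := R) refl (sumQ 4 F) (sumQ n (λ i → F (4 ℕ.+ i))))

module HmixCongruences (p : ℕ) (p-prime : Prime p) (7≤p : 7 ≤ p) where

  open import Defs
  open import Data.Nat as ℕ using (zero; suc; z≤n)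
  import Data.Nat.Properties as ℕ
  open import Data.Rational using (1ℚ; _+_; _*_; -_; _-_)
  open import Data.Rational.Properties using (*-assoc; *-zeroʳ)
  open import Data.Rational.Solver using (module +-*-Solver)
  open import Relation.Binary.PropositionalEquality
  open RationalArithmetic
  open PowerSeriesRing
  open Substitution
  open LogExp
  open SeriesInX
  open PrimeDivisibility p p-prime
  open PAdic p p-prime
  open Frobenius p p-prime
  open PAdicLog p p-prime

  open +-*-Solver

  5≤p : 5 ≤ p
  5≤p = ℕ.≤-trans (ℕ.n≤1+n 5) (ℕ.≤-trans (ℕ.n≤1+n 6) 7≤p)

  4≤p : 4 ≤ p
  4≤p = ℕ.≤-trans (ℕ.n≤1+n 4) 5≤p

  ∣ₛ-etaFactor : ∀ n → p^ 0 ∣ₛ etaFactor n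
  ∣ₛ-etaFactor n = ∣ₛ-mulS {f = powS (subS oneS (monoS 1ℚ (3 ℕ.* n))) 12} {g = invS (powS (subS oneS (monoS 1ℚ n)) 12)}
                            (∣ₛ-factor (3 ℕ.* n)) (∣ₛ-invS (∣ₛ-factor n))
    where
    -- The series are spelled out as in etaFactor: any mismatch makes the checker unfold the twelfth powers.
    ∣ₛ-factor : ∀ k → p^ 0 ∣ₛ powS (subS oneS (monoS 1ℚ k)) 12
    ∣ₛ-factor k = ∣ₛ-powS₀ {subS oneS (monoS 1ℚ k)} 12 (∣ₛ-subS ∣ₛ-oneS (∣ₛ-monoS k (∣ₚ-ℕtoℚ 1)))

  ∣ₛ-prodTo : ∀ N → p^ 0 ∣ₛ prodTo N
  ∣ₛ-prodTo zero    = ∣ₛ-oneS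
  ∣ₛ-prodTo (suc N) = ∣ₛ-mulS (∣ₛ-prodTo N) (∣ₛ-etaFactor (suc N))

  ∣ₛ-etaProd : p^ 0 ∣ₛ etaProd
  ∣ₛ-etaProd n = ∣ₛ-prodTo n n

  ∣ₛ-tq : p^ 0 ∣ₛ tq
  ∣ₛ-tq = ∣ₛ-mulS ∣ₛ-etaProd (∣ₛ-invS (∣ₛ-powS₀ 2 (∣ₛ-addS ∣ₛ-oneS (∣ₛ-scaleS (∣ₚ-ℕtoℚ 27) (∣ₛ-shiftS ∣ₛ-etaProd)))))

  ∣ₛ-Hmix : p^ 0 ∣ₛ Hmix
  ∣ₛ-Hmix = ∣ₛ-invS ∣ₛ-tq

  tq₀ : tq 0 ≡ 1ℚ
  tq₀ = refl

  Hmix₀ : Hmix 0 ≡ 1ℚ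
  Hmix₀ = refl

  tq[qᵖ] : PS
  tq[qᵖ] = substPow p tq

  tq[qᵖ]₀ : tq[qᵖ] 0 ≡ 1ℚ
  tq[qᵖ]₀ = substPow-0 p tq

  tRatio-1 : subS (tRatio p) oneS ≗ mulS (subS (powS tq p) tq[qᵖ]) (invS tq[qᵖ])
  tRatio-1 n = sym (trans (mulS-subˡ (powS tq p) tq[qᵖ] (invS tq[qᵖ]) n)
                          (cong (λ t → tRatio p n - t) (invS-inverseʳ tq[qᵖ] tq[qᵖ]₀ n)))

  -- t(q)^p / t(q^p) = 1 + (tq^p - tq(q^p)) / tq(q^p), and Frobenius puts the fraction in p ℤ_(p)[[q]].
  ∣ₛ-U : p^ 1 ∣ₛ U p
  ∣ₛ-U = ∣ₛ-logS {tRatio p} (∣ₛ-cong (≗-sym tRatio-1)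
    (subst (p^_∣ₛ mulS (subS (powS tq p) tq[qᵖ]) (invS tq[qᵖ])) (ℕ.+-identityʳ 1)
      (∣ₛ-mulS (frobenius ∣ₛ-tq) (∣ₛ-invS (∣ₛ-substPow p ∣ₛ-tq)))))

  ∣ₛ-U₀ : p^ 0 ∣ₛ U p
  ∣ₛ-U₀ = ∣ₛ-weaken z≤n ∣ₛ-U

  logS-Hmix : logS Hmix ≗ scaleS (- 1ℚ) (logS tq)
  logS-Hmix = logS-invS tq tq₀

  logS-Hmix[qᵖ] : logS (substPow p Hmix) ≗ scaleS (- 1ℚ) (substPow p (logS tq))
  logS-Hmix[qᵖ] = ≗-trans (logS-substPow p Hmix Hmix₀)
    (≗-trans (substPow-cong p logS-Hmix) (substPow-scaleS p (- 1ℚ) (logS tq)))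

  U-as-logS : U p ≗ addS (scaleS (ℕtoℚ p) (logS tq)) (scaleS (- 1ℚ) (substPow p (logS tq)))
  U-as-logS = ≗-trans (logS-mulS (powS tq p) (invS tq[qᵖ]) (powS-0-≡1 tq p tq₀) refl)
    (λ n → cong₂ _+_ (logS-powS tq p tq₀ n) (trans (logS-invS tq[qᵖ] tq[qᵖ]₀ n) (cong (- 1ℚ *_) (logS-substPow p tq tq₀ n))))

  p·logS-Hmix : scaleS (ℕtoℚ p) (logS Hmix) ≗ addS (scaleS 1ℚ (logS (substPow p Hmix))) (scaleS (- 1ℚ) (U p))
  p·logS-Hmix n = begin
    ℕtoℚ p * logS Hmix n
      ≡⟨ cong (ℕtoℚ p *_) (logS-Hmix n) ⟩
    ℕtoℚ p * (- 1ℚ * logS tq n)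
      ≡⟨ solve 3 (λ P A B → P :* (con (- 1ℚ) :* A) := con 1ℚ :* (con (- 1ℚ) :* B) :+ con (- 1ℚ) :* (P :* A :+ con (- 1ℚ) :* B))
               refl (ℕtoℚ p) (logS tq n) (substPow p (logS tq) n) ⟩
    1ℚ * (- 1ℚ * substPow p (logS tq) n) + - 1ℚ * (ℕtoℚ p * logS tq n + - 1ℚ * substPow p (logS tq) n)
      ≡⟨ cong₂ (λ s t → 1ℚ * s + - 1ℚ * t) (logS-Hmix[qᵖ] n) (U-as-logS n) ⟨
    1ℚ * logS (substPow p Hmix) n + - 1ℚ * U p n ∎
    where open ≡-Reasoning

  Hmix^pX : ∀ j → fpowX Hmix (ℕtoℚ p) j ≗ mulB (fpowX (substPow p Hmix) 1ℚ) (expB (linX (scaleS (- 1ℚ) (U p)))) j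
  Hmix^pX j = ≗-trans (expB-linX-cong j p·logS-Hmix) (≗-sym (expB-linX-addS (scaleS 1ℚ (logS (substPow p Hmix))) (scaleS (- 1ℚ) (U p)) j))

  Hmix^mp : ∀ m → powS Hmix (m ℕ.* p) ≗ mulS (powS (substPow p Hmix) m) (expS (scaleS (- ℕtoℚ m) (U p)))
  Hmix^mp m = begin
    powS Hmix (m ℕ.* p)                                     ≈⟨ expS-logS (powS Hmix (m ℕ.* p)) (powS-0-≡1 Hmix (m ℕ.* p) Hmix₀) ⟨
    expS (logS (powS Hmix (m ℕ.* p)))                       ≈⟨ expS-cong (≗-trans (logS-powS Hmix (m ℕ.* p) Hmix₀) split) ⟩
    expS (addS (scaleS (ℕtoℚ m) L) V)                       ≈⟨ expS-addS (scaleS (ℕtoℚ m) L) V (*-zeroʳ (ℕtoℚ m)) (*-zeroʳ (- ℕtoℚ m)) ⟩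
    mulS (expS (scaleS (ℕtoℚ m) L)) (expS V)                ≈⟨ mulS-congˡ (expS V) (≗-trans (expS-cong (≗-sym (logS-powS H[qᵖ] m H[qᵖ]₀)))
                                                                                          (expS-logS (powS H[qᵖ] m) (powS-0-≡1 H[qᵖ] m H[qᵖ]₀))) ⟩
    mulS (powS H[qᵖ] m) (expS V)                            ∎
    where
    open ≗-Reasoning
    H[qᵖ] : PS
    H[qᵖ] = substPow p Hmix
    H[qᵖ]₀ : H[qᵖ] 0 ≡ 1ℚ
    H[qᵖ]₀ = substPow-0 p Hmix
    L V : PS
    L = logS H[qᵖ]
    V = scaleS (- ℕtoℚ m) (U p)
    split : scaleS (ℕtoℚ (m ℕ.* p)) (logS Hmix) ≗ addS (scaleS (ℕtoℚ m) L) V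
    split n = trans (cong (_* logS Hmix n) (ℕtoℚ-* m p)) (trans (*-assoc (ℕtoℚ m) (ℕtoℚ p) (logS Hmix n))
      (trans (cong (ℕtoℚ m *_) (p·logS-Hmix n))
             (solve 3 (λ M A B → M :* (con 1ℚ :* A :+ con (- 1ℚ) :* B) := M :* A :+ (:- M) :* B) refl (ℕtoℚ m) (L n) (U p n))))

  ∣ₛ-Hmix^mp-truncation : ∀ m → p^ 4 ∣ₛ subS (powS Hmix (m ℕ.* p)) (mulS (powS (substPow p Hmix) m) (truncatedExp (- ℕtoℚ m) (U p)))
  ∣ₛ-Hmix^mp-truncation m = ∣ₛ-cong difference
    (∣ₛ-mulS {f = powS (substPow p Hmix) m} (∣ₛ-powS₀ m (∣ₛ-substPow p ∣ₛ-Hmix)) (∣ₛ-expS-truncation 5≤p refl (∣ₚ-neg (∣ₚ-ℕtoℚ m)) ∣ₛ-U))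
    where
    Hᵐ : PS
    Hᵐ = powS (substPow p Hmix) m
    difference : mulS Hᵐ (subS (expS (scaleS (- ℕtoℚ m) (U p))) (truncatedExp (- ℕtoℚ m) (U p))) ≗
                 subS (powS Hmix (m ℕ.* p)) (mulS Hᵐ (truncatedExp (- ℕtoℚ m) (U p)))
    difference n = trans (mulS-subʳ Hᵐ (expS (scaleS (- ℕtoℚ m) (U p))) (truncatedExp (- ℕtoℚ m) (U p)) n) (cong (_- mulS Hᵐ (truncatedExp (- ℕtoℚ m) (U p)) n) (sym (Hmix^mp m n)))

open import Defs
open import Data.Nat using (ℕ; _≤_; _<_; _∸_; _*_; _!)
open import Data.Nat.Primality using (Prime)
open import Data.Rational using (ℚ; 0ℚ; 1ℚ; -_) renaming (_*_ to _*ℚ_)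
open import Data.Product using (_×_)
open import Relation.Binary.PropositionalEquality using (_≡_)

open import Data.Nat.Properties using (<-≤-trans)
open import Data.Rational.Properties using (*-identityˡ)
open import Relation.Binary.PropositionalEquality using (refl; sym)
open import Data.Product using (_,_)
open PowerSeriesRing using (≗-sym; ≗-trans)
open Legendre using (legendre-bound)
open SeriesInX using (expB-linX-scaleS; expB-linX-cong; expB-linX≗truncExp3)

lemma3p3 : (p : ℕ) → Prime p → 7 ≤ p →
    -- U_p ∈ p q ℤ_(p)[[q]]
    ((U p 0 ≡ 0ℚ) × ValGe p 1 (U p))
    -- (i)
    × ((∀ k → 1 ≤ k →
          ValGe p (k ∸ vp p (k !)) (scaleS (invFact k) (powS (U p) k))
          × ((p ∸ 1) * vp p (k !) ≤ k ∸ 1))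
       × (∀ k → 4 ≤ k → ValGe p 4 (scaleS (invFact k) (powS (U p) k)))
       × (∀ j → j < 4 → ValGe p 0 (expB (linX (scaleS (- 1ℚ) (U p))) j))
       × (∀ k → 4 ≤ k →
          ValGe p 4 (scaleS (powQ (- 1ℚ) k *ℚ invFact k) (powS (U p) k))))
    -- (ii)
    × (CongP4X4 p (expB (linX (scaleS (- 1ℚ) (U p)))) (truncExp3 (- 1ℚ) (U p))
       × CongP4X4 p (expB (linX (U p))) (truncExp3 1ℚ (U p)))
    -- (iii)
    × (∀ j n → fpowX Hmix (ℕtoℚ p) j n
                ≡ mulB (fpowX (substPow p Hmix) 1ℚ) (expB (linX (scaleS (- 1ℚ) (U p)))) j n)
    -- (iv)
    × (∀ m → 1 ≤ m →
         let rhs = mulS (powS (substPow p Hmix) m)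
                        (sumS 4 (λ l → scaleS (powQ (- ℕtoℚ m) l *ℚ invFact l)
                                              (powS (U p) l)))
         in ValGe p 0 (powS Hmix (m * p)) × ValGe p 0 rhs
            × CongP p 4 (powS Hmix (m * p)) rhs)
lemma3p3 p p-prime 7≤p =
    (refl , ∣ₛ⇒ValGe ∣ₛ-U)
  , ( (λ k _ → ∣ₛ⇒ValGe (∣ₛ-dividedPower k ∣ₛ-U) , legendre-bound p p-prime k)
    , (λ k 4≤k → ∣ₛ⇒ValGe (∣ₛ-dividedPower-≥4 5≤p k 4≤k ∣ₛ-U))
    , (λ j j<4 → ∣ₛ⇒ValGe (∣ₛ-cong (≗-sym (expB-linX-scaleS (- 1ℚ) (U p) j))
                           (∣ₛ-signedDividedPower j −1∣ (∣ₛ-dividedPower-< j (<-≤-trans j<4 4≤p) ∣ₛ-U₀))))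
    , (λ k 4≤k → ∣ₛ⇒ValGe (∣ₛ-signedDividedPower k −1∣ (∣ₛ-dividedPower-≥4 5≤p k 4≤k ∣ₛ-U))))
  , ( (λ j j<4 → ∣ₛ⇒ValGe (∣ₛ-subS-≗ {4} (expB-linX≗truncExp3 (- 1ℚ) (U p) j j<4)))
    , (λ j j<4 → ∣ₛ⇒ValGe (∣ₛ-subS-≗ {4} (≗-trans (expB-linX-cong j (λ n → sym (*-identityˡ (U p n))))
                                              (expB-linX≗truncExp3 1ℚ (U p) j j<4)))))
  , Hmix^pX
  , (λ m _ → ∣ₛ⇒ValGe (∣ₛ-powS₀ (m * p) ∣ₛ-Hmix)
           , ∣ₛ⇒ValGe (∣ₛ-mulS (∣ₛ-powS₀ m (∣ₛ-substPow p ∣ₛ-Hmix)) (∣ₛ-truncatedExp 4≤p (∣ₚ-neg (∣ₚ-ℕtoℚ m)) ∣ₛ-U₀))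
           , ∣ₛ⇒ValGe (∣ₛ-Hmix^mp-truncation m))
  where
  open PAdic p p-prime
  open PAdicLog p p-prime
  open HmixCongruences p p-prime 7≤p
  −1∣ : p^ 0 ∣ₚ (- 1ℚ)
  −1∣ = ∣ₚ-neg (∣ₚ-ℕtoℚ 1)
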